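{- There exists a computable sequence $(h_i)_{i\in\mathbb{N}}$ of hypotheses $h_i:\mathbb{N}\to\{0,1\}$ that converges (pointwise) to a non-computable $h:\mathbb{N}\to\{0,1\}$ of the Turing degree of the halting problem, such that the hypothesis class $\mathcal{H}=\{h\}\cup\{h_i:i\in\mathbb{N}\}$ has effective VC dimension $1$.
   Context: A function $f:\mathbb{N}^{k+1}\to\{0,1\}^{k+1}$ is a $k$-witness for a class $\mathcal{H}$ of functions $\mathbb{N}\to\{0,1\}$ if $f(x_1,\dots,x_{k+1})\ne(g(x_1),\dots,g(x_{k+1}))$ for all $x_1<\dots<x_{k+1}$ in $\mathbb{N}$ and all $g\in\mathcal{H}$. The effective VC dimension $\mathrm{eVCdim}(\mathcal{H})$ is the least $k\in\mathbb{N}$ such that $\mathcal{H}$ admits a computable $k$-witness ($\infty$ if there is none). A sequence $(h_i)$ is computable if $(i,n)\mapsto h_i(n)$ is computable. -}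

module Defs where

open import Data.Nat using (ℕ; zero; suc; _+_; _*_; _^_; _≤_; _<_)
open import Data.Bool using (Bool; true; false)
open import Data.Fin as Fin using (Fin; toℕ)
open import Data.Vec using (Vec; []; _∷_; lookup; map)
open import Data.Product using (Σ; _×_; _,_; ∃)
open import Data.Sum using (_⊎_)
open import Data.Empty using (⊥)
open import Relation.Nullary using (¬_)
open import Relation.Binary.PropositionalEquality using (_≡_; _≢_)

-- A model of computation: (oracle) μ-recursive functions.
-- Code n : programs computing partial functions ℕ^n ⇀ ℕ.
-- 'orc' queries the oracle (a set of naturals).

data Code : ℕ → Set where
  zer  : Code 0
  succ : Code 1
  proj : ∀ {n} → Fin n → Code n
  comp : ∀ {m n} → Code m → Vec (Code n) m → Code n
  prec : ∀ {n} → Code n → Code (suc (suc n)) → Code (suc n)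
  mu   : ∀ {n} → Code (suc n) → Code n
  orc  : Code 1

Oracle : Set₁
Oracle = ℕ → Set

∅ : Oracle
∅ _ = ⊥

-- big-step semantics:  Eval O c xs y  means  c on input xs, with oracle O,
-- halts with output y.
mutual
  data Eval (O : Oracle) : ∀ {n} → Code n → Vec ℕ n → ℕ → Set where
    ev-zer  : Eval O zer [] 0
    ev-succ : ∀ x → Eval O succ (x ∷ []) (suc x)
    ev-proj : ∀ {n} (i : Fin n) (xs : Vec ℕ n) → Eval O (proj i) xs (lookup xs i)
    ev-comp : ∀ {m n} {f : Code m} {gs : Vec (Code n) m} {xs : Vec ℕ n}
                {ys : Vec ℕ m} {z : ℕ} →
              EvalVec O gs xs ys → Eval O f ys z → Eval O (comp f gs) xs z
    ev-prec0 : ∀ {n} {f : Code n} {g : Code (suc (suc n))} {xs : Vec ℕ n} {y : ℕ} →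
              Eval O f xs y → Eval O (prec f g) (0 ∷ xs) y
    ev-precS : ∀ {n} {f : Code n} {g : Code (suc (suc n))} {xs : Vec ℕ n}
                 {k y z : ℕ} →
              Eval O (prec f g) (k ∷ xs) y → Eval O g (k ∷ y ∷ xs) z →
              Eval O (prec f g) (suc k ∷ xs) z
    ev-mu   : ∀ {n} {f : Code (suc n)} {xs : Vec ℕ n} {k : ℕ} →
              Eval O f (k ∷ xs) 0 →
              (∀ j → j < k → Σ ℕ λ v → Eval O f (j ∷ xs) (suc v)) →
              Eval O (mu f) xs k
    ev-orc1 : ∀ {x} → O x → Eval O orc (x ∷ []) 1
    ev-orc0 : ∀ {x} → ¬ O x → Eval O orc (x ∷ []) 0

  data EvalVec (O : Oracle) {n : ℕ} : ∀ {m} → Vec (Code n) m → Vec ℕ n → Vec ℕ m → Set where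
    ev-[] : ∀ {xs} → EvalVec O [] xs []
    ev-∷  : ∀ {m} {g : Code n} {gs : Vec (Code n) m} {xs : Vec ℕ n} {y : ℕ} {ys : Vec ℕ m} →
            Eval O g xs y → EvalVec O gs xs ys → EvalVec O (g ∷ gs) xs (y ∷ ys)

ComputableIn : Oracle → ∀ {n} → (Vec ℕ n → ℕ) → Set
ComputableIn O {n} f = Σ (Code n) λ c → ∀ xs → Eval O c xs (f xs)

Computableⁿ : ∀ {n} → (Vec ℕ n → ℕ) → Set
Computableⁿ = ComputableIn ∅

b2n : Bool → ℕ
b2n true  = 1
b2n false = 0

Computable : (ℕ → Bool) → Set
Computable h = Computableⁿ {1} (λ xs → b2n (h (lookup xs Fin.zero)))

ComputableSeq : (ℕ → ℕ → Bool) → Set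
ComputableSeq hs =
  Computableⁿ {2} (λ xs → b2n (hs (lookup xs Fin.zero) (lookup xs (Fin.suc Fin.zero))))

DecidableIn : Oracle → (ℕ → Set) → Set
DecidableIn O P =
  Σ (Code 1) λ c → ∀ x → (P x → Eval O c (x ∷ []) 1) × (¬ P x → Eval O c (x ∷ []) 0)

_≤T_ : (ℕ → Set) → (ℕ → Set) → Set
P ≤T Q = DecidableIn Q P

⟦_⟧ : (ℕ → Bool) → ℕ → Set
⟦ h ⟧ n = h n ≡ true

pair : ℕ → ℕ → ℕ
pair a b = 2 ^ a * suc (2 * b)

mutual
  ⌜_⌝ : ∀ {n} → Code n → ℕ
  ⌜ zer ⌝ = pair 0 0
  ⌜ succ ⌝ = pair 1 0
  ⌜ proj {n} i ⌝ = pair 2 (pair n (toℕ i))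
  ⌜ comp {m} {n} f gs ⌝ = pair 3 (pair m (pair n (pair ⌜ f ⌝ ⌜ gs ⌝v)))
  ⌜ prec {n} f g ⌝ = pair 4 (pair n (pair ⌜ f ⌝ ⌜ g ⌝))
  ⌜ mu {n} f ⌝ = pair 5 (pair n ⌜ f ⌝)
  ⌜ orc ⌝ = pair 6 0

  ⌜_⌝v : ∀ {m n} → Vec (Code n) m → ℕ
  ⌜ [] ⌝v = 0
  ⌜ g ∷ gs ⌝v = suc (pair ⌜ g ⌝ ⌜ gs ⌝v)

K : ℕ → Set
K e = Σ (Code 1) λ c → ⌜ c ⌝ ≡ e × Σ ℕ λ y → Eval ∅ c (e ∷ []) y

HasDegree0′ : (ℕ → Bool) → Set
HasDegree0′ h = (⟦ h ⟧ ≤T K) × (K ≤T ⟦ h ⟧)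

HypClass : Set₁
HypClass = (ℕ → Bool) → Set

StrictlyIncreasing : ∀ {n} → Vec ℕ n → Set
StrictlyIncreasing {n} xs = ∀ (i j : Fin n) → i Fin.< j → lookup xs i < lookup xs j

IsWitness : (k : ℕ) → HypClass → (Vec ℕ (suc k) → Vec Bool (suc k)) → Set
IsWitness k H f =
  ∀ (xs : Vec ℕ (suc k)) → StrictlyIncreasing xs →
  ∀ (g : ℕ → Bool) → H g → f xs ≢ map g xs

ComputableWitness : (k : ℕ) → (Vec ℕ (suc k) → Vec Bool (suc k)) → Set
ComputableWitness k f = ∀ (j : Fin (suc k)) → Computableⁿ (λ xs → b2n (lookup (f xs) j))

HasComputableWitness : HypClass → ℕ → Set
HasComputableWitness H k =
  Σ (Vec ℕ (suc k) → Vec Bool (suc k)) λ f → ComputableWitness k f × IsWitness k H f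

eVCdim≡ : HypClass → ℕ → Set
eVCdim≡ H k = HasComputableWitness H k × (∀ m → m < k → ¬ HasComputableWitness H m)

SeqClass : (ℕ → Bool) → (ℕ → ℕ → Bool) → HypClass
SeqClass h hs g = (∀ n → g n ≡ h n) ⊎ (Σ ℕ λ i → ∀ n → g n ≡ hs i n)

ConvergesTo : (ℕ → ℕ → Bool) → (ℕ → Bool) → Set
ConvergesTo hs h = ∀ n → Σ ℕ λ N → ∀ i → N ≤ i → hs i n ≡ h n

{-# OPTIONS --safe #-}
module Submission where

-- Each n codes a finite set setOf n (as a list), and sets are compared lexicographically through
-- their characteristic functions. The hypotheses are cuts x ↦ [setOf x ≺ S]: h is the cut at the
-- halting set K and hs i the cut at the i-th stage of a computable enumeration of K, a stage being
-- decided by searching for a certificate of a halting computation.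
-- Every class of cuts has a computable 1-witness: on (a, b) it outputs the labelling that the order
-- between setOf a and setOf b rules out. Since setOf n ≠ K, the stages eventually agree with K up to
-- their first difference, so hs i n → h n. With K as oracle, h n is decided by a search below n;
-- conversely, if R codes K ∩ [0, p) then h decides p ∈ K on the list p ∷ R, because K is infinite.
-- So h ≡T K, and h is not computable because K is not.

open import Defs
open import Level using (0ℓ)
open import Axiom.ExcludedMiddle using (ExcludedMiddle)
open import Data.Nat
open import Data.Nat.Properties
open import Data.Nat.Induction using (<-rec)
open import Data.Bool as Bool using (Bool; true; false; _∧_; _∨_; not; if_then_else_)
open import Data.Bool.Properties using (¬-not)
open import Data.Fin as F using (Fin; toℕ; fromℕ<; #_)
open import Data.Fin.Properties using (toℕ-fromℕ<; toℕ<n)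
open import Data.Vec using (Vec; []; _∷_; lookup; tabulate)
open import Data.Vec.Properties using (tabulate∘lookup; ∷-injectiveˡ; ∷-injectiveʳ)
open import Data.Vec.Relation.Unary.All using (All; []; _∷_)
open import Data.List using (List; []; _∷_) renaming (_++_ to _++ᴸ_)
open import Data.List.Membership.Propositional using (_∈_)
open import Data.List.Membership.Propositional.Properties using (∈-++⁺ˡ; ∈-++⁺ʳ)
open import Data.List.Relation.Unary.Any using (here; there)
open import Data.Product using (Σ; ∃; ∃₂; _×_; _,_; proj₁; proj₂)
open import Data.Sum using (_⊎_; inj₁; inj₂; [_,_]′)
open import Data.Unit using (⊤)
open import Data.Empty using (⊥; ⊥-elim)
open import Function using (_∘_; _$_; id)
open import Relation.Nullary
open import Relation.Nullary.Decidable using (False; toWitnessFalse; dec-true; dec-false)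
open import Relation.Binary.Definitions using (tri<; tri≈; tri>)
open import Relation.Binary.PropositionalEquality

-- Pairing

pair-zero : ∀ b → pair 0 b ≡ suc (2 * b)
pair-zero b = +-identityʳ _

pair-suc : ∀ a b → pair (suc a) b ≡ 2 * pair a b
pair-suc a b = *-assoc 2 (2 ^ a) _

pair-injective : ∀ {a b c d} → pair a b ≡ pair c d → a ≡ c × b ≡ d
pair-injective {zero} {b} {zero} {d} e =
  refl , *-cancelˡ-≡ b d 2 (suc-injective (trans (sym (pair-zero b)) (trans e (pair-zero d))))
pair-injective {zero} {b} {suc c} {d} e =
  ⊥-elim (even≢odd (pair c d) b (sym (trans (sym (pair-zero b)) (trans e (pair-suc c d)))))
pair-injective {suc a} {b} {zero} {d} e =
  ⊥-elim (even≢odd (pair a b) d (trans (sym (pair-suc a b)) (trans e (pair-zero d))))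
pair-injective {suc a} {b} {suc c} {d} e
  with refl , refl ← pair-injective {a} {b} {c} {d}
         (*-cancelˡ-≡ _ _ 2 (trans (sym (pair-suc a b)) (trans e (pair-suc c d))))
  = refl , refl

pair>snd : ∀ a b → b < pair a b
pair>snd a b = <-≤-trans (s≤s (m≤n*m b 2)) (m≤n*m _ (2 ^ a) {{m^n≢0 2 a}})

pair>0 : ∀ a b → 0 < pair a b
pair>0 a b = ≤-<-trans z≤n (pair>snd a b)

pair>fst : ∀ a b → a < pair a b
pair>fst zero b = pair>0 0 b
pair>fst (suc a) b = subst (suc a <_) (sym (pair-suc a b))
  (<-≤-trans (s≤s (pair>fst a b)) (m<m+n (pair a b) (≤-trans (pair>0 a b) (m≤m+n _ 0))))

even-or-odd : ∀ n → ∃ λ m → n ≡ 2 * m ⊎ n ≡ suc (2 * m)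
even-or-odd zero = 0 , inj₁ refl
even-or-odd (suc n) with even-or-odd n
... | m , inj₁ e = m , inj₂ (cong suc e)
... | m , inj₂ e = suc m , inj₁ (trans (cong suc e) (sym (*-distribˡ-+ 2 1 m)))

pair-surjective : ∀ n → 0 < n → ∃₂ λ a b → pair a b ≡ n
pair-surjective = <-rec _ λ n rec pos → decompose n rec pos (even-or-odd n)
  where
  decompose : ∀ n → (∀ {m} → m < n → 0 < m → ∃₂ λ a b → pair a b ≡ m) → 0 < n →
              (∃ λ m → n ≡ 2 * m ⊎ n ≡ suc (2 * m)) → ∃₂ λ a b → pair a b ≡ n
  decompose n rec pos (m , inj₂ e) = 0 , m , trans (pair-zero m) (sym e)
  decompose n rec pos (zero , inj₁ refl) = ⊥-elim (<-irrefl refl pos)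
  decompose n rec pos (suc m , inj₁ refl) with a , b , p ← rec (m<m+n (suc m) z<s) z<s
    = suc a , b , trans (pair-suc a b) (cong (2 *_) p)

-- Opaque so that the typechecker never normalises the powers of 2 inside code numbers.
opaque
  π : ℕ → ℕ → ℕ
  π = pair

  π≡pair : ∀ a b → π a b ≡ pair a b
  π≡pair a b = refl

π-injective : ∀ {a b c d} → π a b ≡ π c d → a ≡ c × b ≡ d
π-injective {a} {b} {c} {d} e = pair-injective (trans (sym (π≡pair a b)) (trans e (π≡pair c d)))

π>fst : ∀ a b → a < π a b
π>fst a b = subst (a <_) (sym (π≡pair a b)) (pair>fst a b)

π>snd : ∀ a b → b < π a b
π>snd a b = subst (b <_) (sym (π≡pair a b)) (pair>snd a b)

π>0 : ∀ a b → 0 < π a b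
π>0 a b = ≤-<-trans z≤n (π>snd a b)

π-surjective : ∀ n → 0 < n → ∃₂ λ a b → π a b ≡ n
π-surjective n pos = let (a , b , e) = pair-surjective n pos in a , b , trans (π≡pair a b) e

-- Bounded search

anyBelow : ℕ → (ℕ → Bool) → Bool
anyBelow zero D = false
anyBelow (suc b) D = anyBelow b D ∨ D b

-- The least y < b with D y, and b if there is none.
minBelow : ℕ → (ℕ → Bool) → ℕ
minBelow zero D = 0
minBelow (suc b) D = if minBelow b D <ᵇ b then minBelow b D else (if D b then b else suc b)

primRec : (ℕ → ℕ → ℕ) → ℕ → ℕ → ℕ
primRec s z zero = z
primRec s z (suc k) = s k (primRec s z k)

ifZero : ℕ → ℕ → ℕ → ℕ
ifZero zero a b = a
ifZero (suc _) a b = b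

≡ᵇ-sound : ∀ m n → (m ≡ᵇ n) ≡ true → m ≡ n
≡ᵇ-sound zero zero e = refl
≡ᵇ-sound zero (suc n) ()
≡ᵇ-sound (suc m) zero ()
≡ᵇ-sound (suc m) (suc n) e = cong suc (≡ᵇ-sound m n e)

≡ᵇ-complete : ∀ m n → m ≡ n → (m ≡ᵇ n) ≡ true
≡ᵇ-complete zero zero e = refl
≡ᵇ-complete (suc m) (suc n) e = ≡ᵇ-complete m n (suc-injective e)
≡ᵇ-complete zero (suc n) ()
≡ᵇ-complete (suc m) zero ()

≢⇒≡ᵇ-false : ∀ m n → m ≢ n → (m ≡ᵇ n) ≡ false
≢⇒≡ᵇ-false m n ne with m ≡ᵇ n in eq
... | false = refl
... | true = ⊥-elim (ne (≡ᵇ-sound m n eq))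

<ᵇ-sound : ∀ m n → (m <ᵇ n) ≡ true → m < n
<ᵇ-sound zero (suc n) e = s≤s z≤n
<ᵇ-sound (suc m) (suc n) e = s≤s (<ᵇ-sound m n e)
<ᵇ-sound m zero ()

<ᵇ-complete : ∀ m n → m < n → (m <ᵇ n) ≡ true
<ᵇ-complete zero (suc n) p = refl
<ᵇ-complete (suc m) (suc n) (s≤s p) = <ᵇ-complete m n p

≤⇒<ᵇ-false : ∀ m n → n ≤ m → (m <ᵇ n) ≡ false
≤⇒<ᵇ-false m zero p = refl
≤⇒<ᵇ-false (suc m) (suc n) (s≤s p) = ≤⇒<ᵇ-false m n p

∧-true⁻ : ∀ {a b} → (a ∧ b) ≡ true → a ≡ true × b ≡ true
∧-true⁻ {true} {true} e = refl , refl
∧-true⁻ {false} ()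
∧-true⁻ {true} {false} ()

∧-true⁺ : ∀ {a b} → a ≡ true → b ≡ true → (a ∧ b) ≡ true
∧-true⁺ refl refl = refl

∨-true⁻ : ∀ {a b} → (a ∨ b) ≡ true → a ≡ true ⊎ b ≡ true
∨-true⁻ {true} e = inj₁ refl
∨-true⁻ {false} e = inj₂ e

∨-true⁺ˡ : ∀ {a b} → a ≡ true → (a ∨ b) ≡ true
∨-true⁺ˡ refl = refl

∨-true⁺ʳ : ∀ {a b} → b ≡ true → (a ∨ b) ≡ true
∨-true⁺ʳ {true} refl = refl
∨-true⁺ʳ {false} refl = refl

not-true⁻ : ∀ {a} → not a ≡ true → a ≡ false
not-true⁻ {false} e = refl
not-true⁻ {true} ()

not-true⁺ : ∀ {a} → a ≡ false → not a ≡ true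
not-true⁺ refl = refl

not-false⁻ : ∀ {a} → not a ≡ false → a ≡ true
not-false⁻ {true} e = refl
not-false⁻ {false} ()

not-false⁺ : ∀ {a} → a ≡ true → not a ≡ false
not-false⁺ refl = refl

true≢false : ∀ {a} → a ≡ true → a ≡ false → ⊥
true≢false refl ()

¬true⇒false : ∀ {a} → ¬ (a ≡ true) → a ≡ false
¬true⇒false {false} _ = refl
¬true⇒false {true} p = ⊥-elim (p refl)

does-true⁻ : ∀ {A : Set} (a? : Dec A) → does a? ≡ true → A
does-true⁻ (yes a) _ = a

bool-ext : ∀ {a b} → (a ≡ true → b ≡ true) → (b ≡ true → a ≡ true) → a ≡ b
bool-ext {true} f g = sym (f refl)
bool-ext {false} {true} f g = g refl
bool-ext {false} {false} f g = refl

anyBelow⁻ : ∀ b D → anyBelow b D ≡ true → ∃ λ y → y < b × D y ≡ true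
anyBelow⁻ zero D ()
anyBelow⁻ (suc b) D e with ∨-true⁻ {anyBelow b D} e
... | inj₁ e′ = let (y , y<b , p) = anyBelow⁻ b D e′ in y , m≤n⇒m≤1+n y<b , p
... | inj₂ e′ = b , ≤-refl , e′

anyBelow⁺ : ∀ b D y → y < b → D y ≡ true → anyBelow b D ≡ true
anyBelow⁺ (suc b) D y y<1+b p with m<1+n⇒m<n∨m≡n y<1+b
... | inj₁ y<b = ∨-true⁺ˡ (anyBelow⁺ b D y y<b p)
... | inj₂ refl = ∨-true⁺ʳ {anyBelow b D} p

anyBelow-false⁻ : ∀ b D → anyBelow b D ≡ false → ∀ y → y < b → D y ≡ false
anyBelow-false⁻ b D e y y<b with D y in eq
... | false = refl
... | true = ⊥-elim (true≢false (anyBelow⁺ b D y y<b eq) e)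

anyBelow-false⁺ : ∀ b D → (∀ y → y < b → D y ≡ false) → anyBelow b D ≡ false
anyBelow-false⁺ b D h with anyBelow b D in eq
... | false = refl
... | true = let (y , y<b , p) = anyBelow⁻ b D eq in ⊥-elim (true≢false p (h y y<b))

minBelow-none : ∀ b D → (∀ z → z < b → D z ≡ false) → minBelow b D ≡ b
minBelow-none zero D h = refl
minBelow-none (suc b) D h
  rewrite minBelow-none b D (λ z z<b → h z (m≤n⇒m≤1+n z<b)) | ≤⇒<ᵇ-false b b ≤-refl | h b ≤-refl = refl

minBelow-least : ∀ b D y → y < b → D y ≡ true → (∀ z → z < y → D z ≡ false) → minBelow b D ≡ y
minBelow-least (suc b) D y y<1+b p h with m<1+n⇒m<n∨m≡n y<1+b
... | inj₁ y<b rewrite minBelow-least b D y y<b p h | <ᵇ-complete y b y<b = refl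
... | inj₂ refl rewrite minBelow-none y D h | ≤⇒<ᵇ-false y y ≤-refl | p = refl

-- A language of bounded arithmetic, compiled into programs

-- Terms and formulas over n variables; orcF queries the oracle, which the semantics receives as
-- a characteristic function χ.
mutual
  data Tm (n : ℕ) : Set where
    var : Fin n → Tm n
    lit : ℕ → Tm n
    sucT : Tm n → Tm n
    addT : Tm n → Tm n → Tm n
    pairT : Tm n → Tm n → Tm n
    itT : Tm n → Tm (suc (suc n)) → Tm n → Tm n
    mnT : Tm n → Fm (suc n) → Tm n
    ifT : Fm n → Tm n → Tm n → Tm n
    appT : ∀ {m} → Tm m → Vec (Tm n) m → Tm n
  data Fm (n : ℕ) : Set where
    eqF ltF : Tm n → Tm n → Fm n
    andF orF : Fm n → Fm n → Fm n
    notF : Fm n → Fm n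
    orcF : Tm n → Fm n
    exF : Tm n → Fm (suc n) → Fm n
    appF : ∀ {m} → Fm m → Vec (Tm n) m → Fm n

mutual
  ⟦_⟧ₜ : ∀ {n} → Tm n → (ℕ → Bool) → Vec ℕ n → ℕ
  ⟦ var i ⟧ₜ χ ρ = lookup ρ i
  ⟦ lit k ⟧ₜ χ ρ = k
  ⟦ sucT t ⟧ₜ χ ρ = suc (⟦ t ⟧ₜ χ ρ)
  ⟦ addT a b ⟧ₜ χ ρ = ⟦ a ⟧ₜ χ ρ + ⟦ b ⟧ₜ χ ρ
  ⟦ pairT a b ⟧ₜ χ ρ = π (⟦ a ⟧ₜ χ ρ) (⟦ b ⟧ₜ χ ρ)
  ⟦ itT z s k ⟧ₜ χ ρ = primRec (λ j r → ⟦ s ⟧ₜ χ (j ∷ r ∷ ρ)) (⟦ z ⟧ₜ χ ρ) (⟦ k ⟧ₜ χ ρ)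
  ⟦ mnT t φ ⟧ₜ χ ρ = minBelow (⟦ t ⟧ₜ χ ρ) (λ y → ⟪ φ ⟫ χ (y ∷ ρ))
  ⟦ ifT φ a b ⟧ₜ χ ρ = if ⟪ φ ⟫ χ ρ then ⟦ a ⟧ₜ χ ρ else ⟦ b ⟧ₜ χ ρ
  ⟦ appT t ts ⟧ₜ χ ρ = ⟦ t ⟧ₜ χ (⟦ ts ⟧ₜ* χ ρ)

  ⟦_⟧ₜ* : ∀ {n m} → Vec (Tm n) m → (ℕ → Bool) → Vec ℕ n → Vec ℕ m
  ⟦ [] ⟧ₜ* χ ρ = []
  ⟦ t ∷ ts ⟧ₜ* χ ρ = ⟦ t ⟧ₜ χ ρ ∷ ⟦ ts ⟧ₜ* χ ρ

  ⟪_⟫ : ∀ {n} → Fm n → (ℕ → Bool) → Vec ℕ n → Bool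
  ⟪ eqF a b ⟫ χ ρ = ⟦ a ⟧ₜ χ ρ ≡ᵇ ⟦ b ⟧ₜ χ ρ
  ⟪ ltF a b ⟫ χ ρ = ⟦ a ⟧ₜ χ ρ <ᵇ ⟦ b ⟧ₜ χ ρ
  ⟪ andF φ ψ ⟫ χ ρ = ⟪ φ ⟫ χ ρ ∧ ⟪ ψ ⟫ χ ρ
  ⟪ orF φ ψ ⟫ χ ρ = ⟪ φ ⟫ χ ρ ∨ ⟪ ψ ⟫ χ ρ
  ⟪ notF φ ⟫ χ ρ = not (⟪ φ ⟫ χ ρ)
  ⟪ orcF t ⟫ χ ρ = χ (⟦ t ⟧ₜ χ ρ)
  ⟪ exF t φ ⟫ χ ρ = anyBelow (⟦ t ⟧ₜ χ ρ) (λ y → ⟪ φ ⟫ χ (y ∷ ρ))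
  ⟪ appF φ ts ⟫ χ ρ = ⟪ φ ⟫ χ (⟦ ts ⟧ₜ* χ ρ)

χ∅ : ℕ → Bool
χ∅ _ = false

consT : ∀ {n} → Tm n → Tm n → Tm n
consT a b = sucT (pairT a b)

v : ∀ {n} (i : ℕ) {p : True (suc i ≤? n)} → Tm n
v i {p} = var (#_ i {m<n = p})

ifZero-≡ᵇ : ∀ x y → ifZero ((x ∸ y) + (y ∸ x)) 1 0 ≡ b2n (x ≡ᵇ y)
ifZero-≡ᵇ zero zero = refl
ifZero-≡ᵇ zero (suc y) = refl
ifZero-≡ᵇ (suc x) zero = refl
ifZero-≡ᵇ (suc x) (suc y) = ifZero-≡ᵇ x y

ifZero-<ᵇ : ∀ x y → ifZero (suc x ∸ y) 1 0 ≡ b2n (x <ᵇ y)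
ifZero-<ᵇ x zero = refl
ifZero-<ᵇ zero (suc zero) = refl
ifZero-<ᵇ zero (suc (suc y)) = refl
ifZero-<ᵇ (suc x) (suc y) = ifZero-<ᵇ x y

ifZero-∧ : ∀ p q → ifZero (b2n p) 0 (b2n q) ≡ b2n (p ∧ q)
ifZero-∧ false q = refl
ifZero-∧ true q = refl

ifZero-∨ : ∀ p q → ifZero (b2n p) (b2n q) 1 ≡ b2n (p ∨ q)
ifZero-∨ false q = refl
ifZero-∨ true q = refl

ifZero-not : ∀ p → ifZero (b2n p) 1 0 ≡ b2n (not p)
ifZero-not false = refl
ifZero-not true = refl

ifZero-if : ∀ p (a b : ℕ) → ifZero (b2n p) b a ≡ (if p then a else b)
ifZero-if false a b = refl
ifZero-if true a b = refl

minBelow-suc : ∀ j D → let m = minBelow j D in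
  ifZero (ifZero (suc m ∸ j) 1 0) (ifZero (b2n (D j)) (suc j) j) m ≡ minBelow (suc j) D
minBelow-suc j D = begin
  ifZero (ifZero (suc m ∸ j) 1 0) X m ≡⟨ cong (λ u → ifZero u X m) (ifZero-<ᵇ m j) ⟩
  ifZero (b2n (m <ᵇ j)) X m            ≡⟨ ifZero-if (m <ᵇ j) m X ⟩
  (if m <ᵇ j then m else X)            ≡⟨ cong (if m <ᵇ j then m else_) (ifZero-if (D j) j (suc j)) ⟩
  minBelow (suc j) D                   ∎
  where
  open ≡-Reasoning
  m = minBelow j D
  X = ifZero (b2n (D j)) (suc j) j

module Compile (O : Oracle) (χ : ℕ → Bool) (orc-correct : ∀ x → Eval O orc (x ∷ []) (b2n (χ x))) where

  zeroC : ∀ {n} → Code n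
  zeroC = comp zer []

  ev-zeroC : ∀ {n} (xs : Vec ℕ n) → Eval O zeroC xs 0
  ev-zeroC xs = ev-comp ev-[] ev-zer

  constC : ∀ {n} → ℕ → Code n
  constC zero = zeroC
  constC (suc k) = comp succ (constC k ∷ [])

  ev-constC : ∀ {n} k (xs : Vec ℕ n) → Eval O (constC k) xs k
  ev-constC zero xs = ev-zeroC xs
  ev-constC (suc k) xs = ev-comp (ev-∷ (ev-constC k xs) ev-[]) (ev-succ k)

  projs : ∀ {m n} → (Fin m → Fin n) → Vec (Code n) m
  projs f = tabulate (λ i → proj (f i))

  ev-projs : ∀ {m n} (f : Fin m → Fin n) (ρ : Vec ℕ n) →
    EvalVec O (projs f) ρ (tabulate (λ i → lookup ρ (f i)))
  ev-projs {zero} f ρ = ev-[]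
  ev-projs {suc m} f ρ = ev-∷ (ev-proj (f F.zero) ρ) (ev-projs (λ i → f (F.suc i)) ρ)

  ids : ∀ {n} → Vec (Code n) n
  ids = projs (λ i → i)

  ev-ids : ∀ {n} (ρ : Vec ℕ n) → EvalVec O ids ρ ρ
  ev-ids ρ = subst (EvalVec O ids ρ) (tabulate∘lookup ρ) (ev-projs (λ i → i) ρ)

  ignoreAcc : ∀ {n} → Code (suc n) → Code (suc (suc n))
  ignoreAcc c = comp c (proj F.zero ∷ projs (λ i → F.suc (F.suc i)))

  ev-ignoreAcc : ∀ {n} (c : Code (suc n)) j r (ρ : Vec ℕ n) y →
    Eval O c (j ∷ ρ) y → Eval O (ignoreAcc c) (j ∷ r ∷ ρ) y
  ev-ignoreAcc c j r ρ y e =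
    ev-comp (ev-∷ (ev-proj F.zero (j ∷ r ∷ ρ))
      (subst (EvalVec O (projs (λ i → F.suc (F.suc i))) (j ∷ r ∷ ρ)) (tabulate∘lookup ρ)
        (ev-projs (λ i → F.suc (F.suc i)) (j ∷ r ∷ ρ)))) e

  addC : Code 2
  addC = prec (proj F.zero) (comp succ (proj (F.suc F.zero) ∷ []))

  ev-addC : ∀ x y → Eval O addC (x ∷ y ∷ []) (x + y)
  ev-addC zero y = ev-prec0 (ev-proj F.zero (y ∷ []))
  ev-addC (suc x) y = ev-precS (ev-addC x y)
    (ev-comp (ev-∷ (ev-proj (F.suc F.zero) (x ∷ (x + y) ∷ y ∷ [])) ev-[]) (ev-succ (x + y)))

  app₂ : ∀ {n} → Code 2 → Code n → Code n → Code n
  app₂ f a b = comp f (a ∷ b ∷ [])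

  ev-app₂ : ∀ {n} {f a b} {ρ : Vec ℕ n} {x y z} → Eval O a ρ x → Eval O b ρ y →
    Eval O f (x ∷ y ∷ []) z → Eval O (app₂ f a b) ρ z
  ev-app₂ ea eb ef = ev-comp (ev-∷ ea (ev-∷ eb ev-[])) ef

  app₁ : ∀ {n} → Code 1 → Code n → Code n
  app₁ f a = comp f (a ∷ [])

  ev-app₁ : ∀ {n} {f a} {ρ : Vec ℕ n} {x z} → Eval O a ρ x →
    Eval O f (x ∷ []) z → Eval O (app₁ f a) ρ z
  ev-app₁ ea ef = ev-comp (ev-∷ ea ev-[]) ef

  arg₀ : ∀ {n} → Code (suc n)
  arg₀ = proj F.zero
  arg₁ : ∀ {n} → Code (suc (suc n))
  arg₁ = proj (F.suc F.zero)
  arg₂ : ∀ {n} → Code (suc (suc (suc n)))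
  arg₂ = proj (F.suc (F.suc F.zero))

  mulC : Code 2
  mulC = prec zeroC (app₂ addC arg₁ arg₂)

  ev-mulC : ∀ x y → Eval O mulC (x ∷ y ∷ []) (x * y)
  ev-mulC zero y = ev-prec0 (ev-zeroC _)
  ev-mulC (suc x) y = ev-precS (ev-mulC x y)
    (subst (Eval O (app₂ addC arg₁ arg₂) (x ∷ x * y ∷ y ∷ [])) (+-comm (x * y) y)
      (ev-app₂ (ev-proj _ _) (ev-proj _ _) (ev-addC (x * y) y)))

  pow2C : Code 1
  pow2C = prec (constC 1) (app₂ addC arg₁ arg₁)

  ev-pow2C : ∀ x → Eval O pow2C (x ∷ []) (2 ^ x)
  ev-pow2C zero = ev-prec0 (ev-constC 1 [])
  ev-pow2C (suc x) = ev-precS (ev-pow2C x)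
    (subst (Eval O (app₂ addC arg₁ arg₁) (x ∷ 2 ^ x ∷ [])) (cong (2 ^ x +_) (sym (+-identityʳ (2 ^ x))))
      (ev-app₂ (ev-proj _ _) (ev-proj _ _) (ev-addC (2 ^ x) (2 ^ x))))

  pairC : Code 2
  pairC = app₂ mulC (app₁ pow2C arg₀) (app₁ succ (app₂ mulC (constC 2) arg₁))

  ev-pairC : ∀ x y → Eval O pairC (x ∷ y ∷ []) (π x y)
  ev-pairC x y = subst (Eval O pairC (x ∷ y ∷ [])) (sym (π≡pair x y))
    (ev-app₂ (ev-app₁ (ev-proj _ _) (ev-pow2C x))
             (ev-app₁ (ev-app₂ (ev-constC 2 _) (ev-proj _ _) (ev-mulC 2 y)) (ev-succ _))
             (ev-mulC _ _))

  predC : Code 1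
  predC = prec zeroC arg₀

  ev-predC : ∀ x → Eval O predC (x ∷ []) (pred x)
  ev-predC zero = ev-prec0 (ev-zeroC [])
  ev-predC (suc x) = ev-precS (ev-predC x) (ev-proj F.zero _)

  flipMonusC : Code 2
  flipMonusC = prec arg₀ (app₁ predC arg₁)

  ev-flipMonusC : ∀ y x → Eval O flipMonusC (y ∷ x ∷ []) (x ∸ y)
  ev-flipMonusC zero x = ev-prec0 (ev-proj F.zero _)
  ev-flipMonusC (suc y) x = ev-precS (ev-flipMonusC y x)
    (subst (Eval O (app₁ predC arg₁) (y ∷ x ∸ y ∷ x ∷ [])) (pred[m∸n]≡m∸[1+n] x y)
      (ev-app₁ (ev-proj _ _) (ev-predC (x ∸ y))))

  monusC : Code 2
  monusC = app₂ flipMonusC arg₁ arg₀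

  ev-monusC : ∀ x y → Eval O monusC (x ∷ y ∷ []) (x ∸ y)
  ev-monusC x y = ev-app₂ (ev-proj _ _) (ev-proj _ _) (ev-flipMonusC y x)

  ifZeroC : Code 3
  ifZeroC = prec arg₀ (proj (F.suc (F.suc (F.suc F.zero))))

  ev-ifZeroC : ∀ c a b → Eval O ifZeroC (c ∷ a ∷ b ∷ []) (ifZero c a b)
  ev-ifZeroC zero a b = ev-prec0 (ev-proj _ _)
  ev-ifZeroC (suc c) a b = ev-precS (ev-ifZeroC c a b) (ev-proj _ _)

  app₃ : ∀ {n} → Code 3 → Code n → Code n → Code n → Code n
  app₃ f a b c = comp f (a ∷ b ∷ c ∷ [])

  ev-app₃ : ∀ {n} {f a b c} {ρ : Vec ℕ n} {x y z w} → Eval O a ρ x → Eval O b ρ y →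
    Eval O c ρ z → Eval O f (x ∷ y ∷ z ∷ []) w → Eval O (app₃ f a b c) ρ w
  ev-app₃ ea eb ec ef = ev-comp (ev-∷ ea (ev-∷ eb (ev-∷ ec ev-[]))) ef

  ifC : ∀ {n} → Code n → Code n → Code n → Code n
  ifC = app₃ ifZeroC

  ev-ifC : ∀ {n} {c a b} {ρ : Vec ℕ n} {x y z} → Eval O c ρ x → Eval O a ρ y →
    Eval O b ρ z → Eval O (ifC c a b) ρ (ifZero x y z)
  ev-ifC ec ea eb = ev-app₃ ec ea eb (ev-ifZeroC _ _ _)

  isZeroC : ∀ {n} → Code n → Code n
  isZeroC c = ifC c (constC 1) (constC 0)

  ev-isZeroC : ∀ {n} {c} {ρ : Vec ℕ n} {x} → Eval O c ρ x → Eval O (isZeroC c) ρ (ifZero x 1 0)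
  ev-isZeroC ec = ev-ifC ec (ev-constC 1 _) (ev-constC 0 _)

  Eval-≡ : ∀ {n} {c} {ρ : Vec ℕ n} {x y} → x ≡ y → Eval O c ρ x → Eval O c ρ y
  Eval-≡ refl e = e

  -- Steps of the recursions computing minBelow and anyBelow: arg₀ is the counter, arg₁ the
  -- value so far.
  minStepC anyStepC : ∀ {n} → Code (suc n) → Code (suc (suc n))
  minStepC c = ifC (isZeroC (app₂ monusC (app₁ succ arg₁) arg₀)) (ifC (ignoreAcc c) (app₁ succ arg₀) arg₀) arg₁
  anyStepC c = ifC arg₁ (ignoreAcc c) (constC 1)

  mutual
    compileT : ∀ {n} → Tm n → Code n
    compileT (var i) = proj i
    compileT (lit k) = constC k
    compileT (sucT t) = app₁ succ (compileT t)
    compileT (addT a b) = app₂ addC (compileT a) (compileT b)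
    compileT (pairT a b) = app₂ pairC (compileT a) (compileT b)
    compileT (itT z s k) = comp (prec (compileT z) (compileT s)) (compileT k ∷ ids)
    compileT (mnT t φ) = comp (prec zeroC (minStepC (compileF φ))) (compileT t ∷ ids)
    compileT (ifT φ a b) = ifC (compileF φ) (compileT b) (compileT a)
    compileT (appT t ts) = comp (compileT t) (compileTs ts)

    compileTs : ∀ {n m} → Vec (Tm n) m → Vec (Code n) m
    compileTs [] = []
    compileTs (t ∷ ts) = compileT t ∷ compileTs ts

    compileF : ∀ {n} → Fm n → Code n
    compileF (eqF a b) = isZeroC (app₂ addC (app₂ monusC (compileT a) (compileT b)) (app₂ monusC (compileT b) (compileT a)))
    compileF (ltF a b) = isZeroC (app₂ monusC (app₁ succ (compileT a)) (compileT b))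
    compileF (andF φ ψ) = ifC (compileF φ) (constC 0) (compileF ψ)
    compileF (orF φ ψ) = ifC (compileF φ) (compileF ψ) (constC 1)
    compileF (notF φ) = isZeroC (compileF φ)
    compileF (orcF t) = app₁ orc (compileT t)
    compileF (exF t φ) = comp (prec zeroC (anyStepC (compileF φ))) (compileT t ∷ ids)
    compileF (appF φ ts) = comp (compileF φ) (compileTs ts)

  mutual
    compileT-correct : ∀ {n} (t : Tm n) (ρ : Vec ℕ n) → Eval O (compileT t) ρ (⟦ t ⟧ₜ χ ρ)
    compileT-correct (var i) ρ = ev-proj i ρ
    compileT-correct (lit k) ρ = ev-constC k ρ
    compileT-correct (sucT t) ρ = ev-app₁ (compileT-correct t ρ) (ev-succ _)
    compileT-correct (addT a b) ρ = ev-app₂ (compileT-correct a ρ) (compileT-correct b ρ) (ev-addC _ _)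
    compileT-correct (pairT a b) ρ = ev-app₂ (compileT-correct a ρ) (compileT-correct b ρ) (ev-pairC _ _)
    compileT-correct (itT z s k) ρ = ev-comp (ev-∷ (compileT-correct k ρ) (ev-ids ρ)) (ev-primRec (⟦ k ⟧ₜ χ ρ))
      where
      ev-primRec : ∀ j → Eval O (prec (compileT z) (compileT s)) (j ∷ ρ)
                             (primRec (λ j r → ⟦ s ⟧ₜ χ (j ∷ r ∷ ρ)) (⟦ z ⟧ₜ χ ρ) j)
      ev-primRec zero = ev-prec0 (compileT-correct z ρ)
      ev-primRec (suc j) = ev-precS (ev-primRec j) (compileT-correct s _)
    compileT-correct (mnT t φ) ρ = ev-comp (ev-∷ (compileT-correct t ρ) (ev-ids ρ)) (ev-minBelow (⟦ t ⟧ₜ χ ρ))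
      where
      D : ℕ → Bool
      D y = ⟪ φ ⟫ χ (y ∷ ρ)
      ev-minBelow : ∀ j → Eval O (prec zeroC (minStepC (compileF φ))) (j ∷ ρ) (minBelow j D)
      ev-minBelow zero = ev-prec0 (ev-zeroC ρ)
      ev-minBelow (suc j) = ev-precS (ev-minBelow j)
        (Eval-≡ (minBelow-suc j D)
          (ev-ifC (ev-isZeroC (ev-app₂ (ev-app₁ (ev-proj _ _) (ev-succ _)) (ev-proj _ _) (ev-monusC _ _)))
                 (ev-ifC (ev-ignoreAcc (compileF φ) j (minBelow j D) ρ _ (compileF-correct φ (j ∷ ρ)))
                         (ev-app₁ (ev-proj _ _) (ev-succ _)) (ev-proj _ _))
                 (ev-proj _ _)))
    compileT-correct (ifT φ a b) ρ = Eval-≡ (ifZero-if (⟪ φ ⟫ χ ρ) _ _)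
      (ev-ifC (compileF-correct φ ρ) (compileT-correct b ρ) (compileT-correct a ρ))
    compileT-correct (appT t ts) ρ = ev-comp (compileTs-correct ts ρ) (compileT-correct t _)

    compileTs-correct : ∀ {n m} (ts : Vec (Tm n) m) (ρ : Vec ℕ n) → EvalVec O (compileTs ts) ρ (⟦ ts ⟧ₜ* χ ρ)
    compileTs-correct [] ρ = ev-[]
    compileTs-correct (t ∷ ts) ρ = ev-∷ (compileT-correct t ρ) (compileTs-correct ts ρ)

    compileF-correct : ∀ {n} (φ : Fm n) (ρ : Vec ℕ n) → Eval O (compileF φ) ρ (b2n (⟪ φ ⟫ χ ρ))
    compileF-correct (eqF a b) ρ = Eval-≡ (ifZero-≡ᵇ (⟦ a ⟧ₜ χ ρ) (⟦ b ⟧ₜ χ ρ))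
      (ev-isZeroC (ev-app₂ (ev-app₂ (compileT-correct a ρ) (compileT-correct b ρ) (ev-monusC _ _))
                           (ev-app₂ (compileT-correct b ρ) (compileT-correct a ρ) (ev-monusC _ _))
                           (ev-addC _ _)))
    compileF-correct (ltF a b) ρ = Eval-≡ (ifZero-<ᵇ (⟦ a ⟧ₜ χ ρ) (⟦ b ⟧ₜ χ ρ))
      (ev-isZeroC (ev-app₂ (ev-app₁ (compileT-correct a ρ) (ev-succ _)) (compileT-correct b ρ) (ev-monusC _ _)))
    compileF-correct (andF φ ψ) ρ = Eval-≡ (ifZero-∧ (⟪ φ ⟫ χ ρ) (⟪ ψ ⟫ χ ρ))
      (ev-ifC (compileF-correct φ ρ) (ev-constC 0 ρ) (compileF-correct ψ ρ))
    compileF-correct (orF φ ψ) ρ = Eval-≡ (ifZero-∨ (⟪ φ ⟫ χ ρ) (⟪ ψ ⟫ χ ρ))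
      (ev-ifC (compileF-correct φ ρ) (compileF-correct ψ ρ) (ev-constC 1 ρ))
    compileF-correct (notF φ) ρ = Eval-≡ (ifZero-not (⟪ φ ⟫ χ ρ)) (ev-isZeroC (compileF-correct φ ρ))
    compileF-correct (orcF t) ρ = ev-app₁ (compileT-correct t ρ) (orc-correct _)
    compileF-correct (exF t φ) ρ = ev-comp (ev-∷ (compileT-correct t ρ) (ev-ids ρ)) (ev-anyBelow (⟦ t ⟧ₜ χ ρ))
      where
      D : ℕ → Bool
      D y = ⟪ φ ⟫ χ (y ∷ ρ)
      ev-anyBelow : ∀ j → Eval O (prec zeroC (anyStepC (compileF φ))) (j ∷ ρ) (b2n (anyBelow j D))
      ev-anyBelow zero = ev-prec0 (ev-zeroC ρ)
      ev-anyBelow (suc j) = ev-precS (ev-anyBelow j)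
        (Eval-≡ (ifZero-∨ (anyBelow j D) (D j))
          (ev-ifC (ev-proj _ _) (ev-ignoreAcc (compileF φ) j _ ρ _ (compileF-correct φ (j ∷ ρ))) (ev-constC 1 _)))
    compileF-correct (appF φ ts) ρ = ev-comp (compileTs-correct ts ρ) (compileF-correct φ _)

  Fm-computable : ∀ {n} (φ : Fm n) → ComputableIn O (λ xs → b2n (⟪ φ ⟫ χ xs))
  Fm-computable φ = compileF φ , compileF-correct φ

  decides : ∀ (φ : Fm 1) {P : ℕ → Set} →
    (∀ x → (P x → ⟪ φ ⟫ χ (x ∷ []) ≡ true) × (¬ P x → ⟪ φ ⟫ χ (x ∷ []) ≡ false)) → DecidableIn O P
  decides φ spec = compileF φ , λ x →
    (λ p → subst (Eval O (compileF φ) (x ∷ [])) (cong b2n (proj₁ (spec x) p)) (compileF-correct φ (x ∷ []))) ,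
    (λ ¬p → subst (Eval O (compileF φ) (x ∷ [])) (cong b2n (proj₂ (spec x) ¬p)) (compileF-correct φ (x ∷ [])))

Holds : ∀ {n} → Fm n → (ℕ → Bool) → Vec ℕ n → Set
Holds (eqF a b) χ ρ = ⟦ a ⟧ₜ χ ρ ≡ ⟦ b ⟧ₜ χ ρ
Holds (ltF a b) χ ρ = ⟦ a ⟧ₜ χ ρ < ⟦ b ⟧ₜ χ ρ
Holds (andF φ ψ) χ ρ = Holds φ χ ρ × Holds ψ χ ρ
Holds (orF φ ψ) χ ρ = Holds φ χ ρ ⊎ Holds ψ χ ρ
Holds (notF φ) χ ρ = ⟪ φ ⟫ χ ρ ≡ false
Holds (orcF t) χ ρ = χ (⟦ t ⟧ₜ χ ρ) ≡ true
Holds (exF t φ) χ ρ = Σ ℕ λ y → y < ⟦ t ⟧ₜ χ ρ × Holds φ χ (y ∷ ρ)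
Holds (appF φ ts) χ ρ = ⟪ φ ⟫ χ (⟦ ts ⟧ₜ* χ ρ) ≡ true

true⇒Holds : ∀ {n} (φ : Fm n) χ ρ → ⟪ φ ⟫ χ ρ ≡ true → Holds φ χ ρ
true⇒Holds (eqF a b) χ ρ e = ≡ᵇ-sound _ _ e
true⇒Holds (ltF a b) χ ρ e = <ᵇ-sound _ _ e
true⇒Holds (andF φ ψ) χ ρ e =
  let (e₁ , e₂) = ∧-true⁻ {⟪ φ ⟫ χ ρ} e in true⇒Holds φ χ ρ e₁ , true⇒Holds ψ χ ρ e₂
true⇒Holds (orF φ ψ) χ ρ e with ∨-true⁻ {⟪ φ ⟫ χ ρ} e
... | inj₁ e₁ = inj₁ (true⇒Holds φ χ ρ e₁)
... | inj₂ e₂ = inj₂ (true⇒Holds ψ χ ρ e₂)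
true⇒Holds (notF φ) χ ρ e = not-true⁻ e
true⇒Holds (orcF t) χ ρ e = e
true⇒Holds (exF t φ) χ ρ e = let (y , y< , e′) = anyBelow⁻ _ _ e in y , y< , true⇒Holds φ χ (y ∷ ρ) e′
true⇒Holds (appF φ ts) χ ρ e = e

Holds⇒true : ∀ {n} (φ : Fm n) χ ρ → Holds φ χ ρ → ⟪ φ ⟫ χ ρ ≡ true
Holds⇒true (eqF a b) χ ρ h = ≡ᵇ-complete _ _ h
Holds⇒true (ltF a b) χ ρ h = <ᵇ-complete _ _ h
Holds⇒true (andF φ ψ) χ ρ (h₁ , h₂) = ∧-true⁺ (Holds⇒true φ χ ρ h₁) (Holds⇒true ψ χ ρ h₂)
Holds⇒true (orF φ ψ) χ ρ (inj₁ h) = ∨-true⁺ˡ (Holds⇒true φ χ ρ h)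
Holds⇒true (orF φ ψ) χ ρ (inj₂ h) = ∨-true⁺ʳ {⟪ φ ⟫ χ ρ} (Holds⇒true ψ χ ρ h)
Holds⇒true (notF φ) χ ρ h = not-true⁺ h
Holds⇒true (orcF t) χ ρ h = h
Holds⇒true (exF t φ) χ ρ (y , y< , h) = anyBelow⁺ _ _ y y< (Holds⇒true φ χ (y ∷ ρ) h)
Holds⇒true (appF φ ts) χ ρ h = h

⋁ : ∀ {n m} → Vec (Fm n) m → Fm n
⋁ [] = ltF (lit 0) (lit 0)
⋁ (φ ∷ φs) = orF φ (⋁ φs)

⋁-elim : ∀ {n m} (φs : Vec (Fm n) m) {χ ρ} {X : Set} →
  All (λ φ → Holds φ χ ρ → X) φs → ⟪ ⋁ φs ⟫ χ ρ ≡ true → X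
⋁-elim (φ ∷ φs) {χ} {ρ} (f ∷ fs) e with ∨-true⁻ {⟪ φ ⟫ χ ρ} e
... | inj₁ e₁ = f (true⇒Holds φ χ ρ e₁)
... | inj₂ e₂ = ⋁-elim φs fs e₂

⋁⁺ : ∀ {n m} (φs : Vec (Fm n) m) {χ ρ} → (∃ λ i → Holds (lookup φs i) χ ρ) → ⟪ ⋁ φs ⟫ χ ρ ≡ true
⋁⁺ (φ ∷ φs) (F.zero , h) = ∨-true⁺ˡ (Holds⇒true φ _ _ h)
⋁⁺ (φ ∷ φs) {χ} {ρ} (F.suc i , h) = ∨-true⁺ʳ {⟪ φ ⟫ χ ρ} (⋁⁺ φs (i , h))

-- Lists are coded by numbers: 0 is the empty list and π x r is x followed by the list r.
tailT : Tm 1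
tailT = mnT (v 0) (exF (v 1) (eqF (v 2) (pairT (v 0) (v 1))))

tail : ℕ → ℕ
tail L = ⟦ tailT ⟧ₜ χ∅ (L ∷ [])

dropT : Tm 2
dropT = itT (v 1) (appT tailT (v 1 ∷ [])) (v 0)

drop : ℕ → ℕ → ℕ
drop i L = ⟦ dropT ⟧ₜ χ∅ (i ∷ L ∷ [])

setOfFm : Fm 2
setOfFm = exF (v 0) (exF (v 1) (eqF (appT dropT (v 1 ∷ v 2 ∷ [])) (pairT (v 3) (v 0))))

setOf : ℕ → ℕ → Bool
setOf L q = ⟪ setOfFm ⟫ χ∅ (L ∷ q ∷ [])

tail-π : ∀ x r → tail (π x r) ≡ r
tail-π x r = minBelow-least (π x r) _ r (π>snd x r)
  (anyBelow⁺ (π x r) _ x (π>fst x r) (≡ᵇ-complete (π x r) (π x r) refl))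
  (λ z z<r → anyBelow-false⁺ (π x r) _ λ x′ _ →
     ≢⇒≡ᵇ-false _ _ λ e → <-irrefl (sym (proj₂ (π-injective e))) z<r)

tail< : ∀ L → 0 < L → tail L < L
tail< L pos with x , r , refl ← π-surjective L pos rewrite tail-π x r = π>snd x r

tail≤ : ∀ L → tail L ≤ L
tail≤ zero = z≤n
tail≤ (suc L) = <⇒≤ (tail< (suc L) z<s)

drop-suc : ∀ i L → drop (suc i) L ≡ drop i (tail L)
drop-suc zero L = refl
drop-suc (suc i) L = cong tail (drop-suc i L)

drop-suc-π : ∀ i x r → drop (suc i) (π x r) ≡ drop i r
drop-suc-π i x r = trans (drop-suc i (π x r)) (cong (drop i) (tail-π x r))

drop≤ : ∀ i L → drop i L ≤ L
drop≤ zero L = ≤-refl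
drop≤ (suc i) L = ≤-trans (tail≤ (drop i L)) (drop≤ i L)

drop-bound : ∀ i L → 0 < drop i L → i + drop i L ≤ L
drop-bound zero L pos = ≤-refl
drop-bound (suc i) L pos with drop i L in eq
... | zero = ⊥-elim (<-irrefl refl pos)
... | suc T with drop-bound i L (subst (0 <_) (sym eq) z<s)
... | ih rewrite eq = ≤-trans (subst (_≤ i + suc T) (+-suc i (tail (suc T))) (+-monoʳ-≤ i (tail< (suc T) z<s))) ih

drop≡π⇒bounded : ∀ i L {x r} → drop i L ≡ π x r → i < L × x < L × r < L
drop≡π⇒bounded i L {x} {r} eq =
  <-≤-trans (m<m+n i pos) (drop-bound i L pos) , <-≤-trans (π>fst x r) ≤L , <-≤-trans (π>snd x r) ≤L
  where
  pos : 0 < drop i L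
  pos = subst (0 <_) (sym eq) (π>0 x r)
  ≤L : π x r ≤ L
  ≤L = subst (_≤ L) eq (drop≤ i L)

setOf⁻ : ∀ L q → setOf L q ≡ true → ∃₂ λ i r → drop i L ≡ π q r
setOf⁻ L q e with i , _ , e′ ← anyBelow⁻ L _ e with r , _ , e″ ← anyBelow⁻ L _ e′ =
  i , r , ≡ᵇ-sound _ _ e″

setOf⁺ : ∀ L q i r → drop i L ≡ π q r → setOf L q ≡ true
setOf⁺ L q i r e = let (i< , _ , r<) = drop≡π⇒bounded i L e in
  anyBelow⁺ L _ i i< (anyBelow⁺ L _ r r< (≡ᵇ-complete (drop i L) (π q r) e))

setOf-bounded : ∀ L q → setOf L q ≡ true → q < L
setOf-bounded L q e with i , r , eq ← setOf⁻ L q e = proj₁ (proj₂ (drop≡π⇒bounded i L eq))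

setOf-π⁻ : ∀ x r q → setOf (π x r) q ≡ true → x ≡ q ⊎ setOf r q ≡ true
setOf-π⁻ x r q e with setOf⁻ (π x r) q e
... | zero , r′ , eq = inj₁ (proj₁ (π-injective eq))
... | suc i , r′ , eq = inj₂ (setOf⁺ r q i r′ (trans (sym (drop-suc-π i x r)) eq))

setOf-π⁺ : ∀ x r q → x ≡ q ⊎ setOf r q ≡ true → setOf (π x r) q ≡ true
setOf-π⁺ x r q (inj₁ refl) = setOf⁺ (π x r) x 0 r refl
setOf-π⁺ x r q (inj₂ e) with i , r′ , eq ← setOf⁻ r q e =
  setOf⁺ (π x r) q (suc i) r′ (trans (drop-suc-π i x r) eq)

validFm : Fm 2 → Fm 1
validFm J = notF (exF (v 0) (exF (v 1) (exF (v 2)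
  (andF (eqF (appT dropT (v 2 ∷ v 3 ∷ [])) (pairT (v 1) (v 0))) (notF (appF J (v 1 ∷ v 0 ∷ [])))))))

-- A list is valid for J when each of its entries x satisfies J x r, r being the list after x.
module Valid (J : Fm 2) where
  holdsJ : ℕ → ℕ → Bool
  holdsJ x r = ⟪ J ⟫ χ∅ (x ∷ r ∷ [])

  valid : ℕ → Bool
  valid L = ⟪ validFm J ⟫ χ∅ (L ∷ [])

  valid⁻ : ∀ L → valid L ≡ true → ∀ i x r → drop i L ≡ π x r → holdsJ x r ≡ true
  valid⁻ L e i x r eq with holdsJ x r in jq
  ... | true = refl
  ... | false = let (i< , x< , r<) = drop≡π⇒bounded i L eq in ⊥-elim (true≢false
      (anyBelow⁺ L _ i i< (anyBelow⁺ L _ x x< (anyBelow⁺ L _ r r< (∧-true⁺ (≡ᵇ-complete _ _ eq) (not-true⁺ jq)))))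
      (not-true⁻ e))

  valid⁺ : ∀ L → (∀ i x r → drop i L ≡ π x r → holdsJ x r ≡ true) → valid L ≡ true
  valid⁺ L h = not-true⁺ (anyBelow-false⁺ L _ λ i _ → anyBelow-false⁺ L _ λ x _ → anyBelow-false⁺ L _ λ r _ →
    no-counterexample i x r)
    where
    no-counterexample : ∀ i x r → ((drop i L ≡ᵇ π x r) ∧ not (holdsJ x r)) ≡ false
    no-counterexample i x r with drop i L ≡ᵇ π x r in eq
    ... | false = refl
    ... | true rewrite h i x r (≡ᵇ-sound _ _ eq) = refl

  valid-π⁻ : ∀ x r → valid (π x r) ≡ true → holdsJ x r ≡ true × valid r ≡ true
  valid-π⁻ x r e = valid⁻ (π x r) e 0 x r refl ,
    valid⁺ r λ i x′ r′ eq → valid⁻ (π x r) e (suc i) x′ r′ (trans (drop-suc-π i x r) eq)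

  valid-π⁺ : ∀ x r → holdsJ x r ≡ true → valid r ≡ true → valid (π x r) ≡ true
  valid-π⁺ x r j vr = valid⁺ (π x r) entry
    where
    entry : ∀ i x′ r′ → drop i (π x r) ≡ π x′ r′ → holdsJ x′ r′ ≡ true
    entry zero x′ r′ eq with refl , refl ← π-injective {x} {r} {x′} {r′} eq = j
    entry (suc i) x′ r′ eq = valid⁻ r vr i x′ r′ (trans (sym (drop-suc-π i x r)) eq)

-- Certified computations

-- A computation is certified by a list of judgements, each following from later ones by a rule
-- mirroring Eval. Validity of a list is a bounded formula, hence decidable; valid lists are sound
-- (valid⇒sound), and every computation has one (certify-eval).
cons : ℕ → ℕ → ℕ
cons x r = suc (π x r)

encV : ∀ {n} → Vec ℕ n → ℕ
encV [] = 0
encV (x ∷ v) = cons x (encV v)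

judgement : ℕ → ℕ → ℕ → ℕ → ℕ
judgement k a b c = π k (π a (π b c))

-- The judgements derived below: evalJ c xs y says that the program coded c outputs y on the
-- inputs coded xs (by encV), evalsJ is its analogue for vectors of programs, lookupJ xs i y
-- says that entry i of xs is y, codeJ c n that c codes a program of arity n, and codesJ gs m n
-- that gs codes m programs of arity n.
evalJ evalsJ lookupJ codesJ : ℕ → ℕ → ℕ → ℕ
evalJ = judgement 0
evalsJ = judgement 1
lookupJ = judgement 2
codesJ = judgement 4

codeJ : ℕ → ℕ → ℕ
codeJ c n = judgement 3 c n 0

-- The clauses of ⌜_⌝, with π in place of pair.
zerN succN orcN : ℕ
zerN = π 0 0
succN = π 1 0
orcN = π 6 0

projN muN : ℕ → ℕ → ℕ
projN n i = π 2 (π n i)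
muN n f = π 5 (π n f)

precN : ℕ → ℕ → ℕ → ℕ
precN n f g = π 4 (π n (π f g))

compN : ℕ → ℕ → ℕ → ℕ → ℕ
compN m n f gs = π 3 (π m (π n (π f gs)))

data Rule (M : ℕ → Set) : ℕ → Set where
  eval-zer : Rule M (evalJ zerN 0 0)
  eval-succ : ∀ x → Rule M (evalJ succN (cons x 0) (suc x))
  eval-proj : ∀ n i xs y → M (lookupJ xs i y) → Rule M (evalJ (projN n i) xs y)
  eval-comp : ∀ m n f gs xs ys y → M (evalsJ gs xs ys) → M (evalJ f ys y) →
    Rule M (evalJ (compN m n f gs) xs y)
  eval-prec0 : ∀ n f g xs y → M (evalJ f xs y) → Rule M (evalJ (precN n f g) (cons 0 xs) y)
  eval-precS : ∀ n f g k xs y z → M (evalJ (precN n f g) (cons k xs) y) →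
    M (evalJ g (cons k (cons y xs)) z) → Rule M (evalJ (precN n f g) (cons (suc k) xs) z)
  eval-mu : ∀ n f xs k → M (evalJ f (cons k xs) 0) →
    (∀ j → j < k → ∃ λ w → M (evalJ f (cons j xs) (suc w))) → Rule M (evalJ (muN n f) xs k)
  -- Only computations without oracle are certified: there every query is answered 0.
  eval-orc : ∀ x → Rule M (evalJ orcN (cons x 0) 0)
  evals-[] : ∀ xs → Rule M (evalsJ 0 xs 0)
  evals-∷ : ∀ g gs xs y ys → M (evalJ g xs y) → M (evalsJ gs xs ys) →
    Rule M (evalsJ (cons g gs) xs (cons y ys))
  lookup-zero : ∀ y r → Rule M (lookupJ (cons y r) 0 y)
  lookup-suc : ∀ x r i y → M (lookupJ r i y) → Rule M (lookupJ (cons x r) (suc i) y)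
  code-zer : Rule M (codeJ zerN 0)
  code-succ : Rule M (codeJ succN 1)
  code-proj : ∀ n i → i < n → Rule M (codeJ (projN n i) n)
  code-comp : ∀ m n f gs → M (codeJ f m) → M (codesJ gs m n) → Rule M (codeJ (compN m n f gs) n)
  code-prec : ∀ n f g → M (codeJ f n) → M (codeJ g (suc (suc n))) → Rule M (codeJ (precN n f g) (suc n))
  code-mu : ∀ n f → M (codeJ f (suc n)) → Rule M (codeJ (muN n f) n)
  code-orc : Rule M (codeJ orcN 1)
  codes-[] : ∀ n → Rule M (codesJ 0 0 n)
  codes-∷ : ∀ g gs m n → M (codeJ g n) → M (codesJ gs m n) → Rule M (codesJ (cons g gs) (suc m) n)

Rule-map : ∀ {M M′ : ℕ → Set} {l} → (∀ {l′} → M l′ → M′ l′) → Rule M l → Rule M′ l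
Rule-map f eval-zer = eval-zer
Rule-map f (eval-succ x) = eval-succ x
Rule-map f (eval-proj n i xs y p) = eval-proj n i xs y (f p)
Rule-map f (eval-comp m n g gs xs ys y p q) = eval-comp m n g gs xs ys y (f p) (f q)
Rule-map f (eval-prec0 n g h xs y p) = eval-prec0 n g h xs y (f p)
Rule-map f (eval-precS n g h k xs y z p q) = eval-precS n g h k xs y z (f p) (f q)
Rule-map f (eval-mu n g xs k p ps) = eval-mu n g xs k (f p) λ j j<k → let (w , q) = ps j j<k in w , f q
Rule-map f (eval-orc x) = eval-orc x
Rule-map f (evals-[] xs) = evals-[] xs
Rule-map f (evals-∷ g gs xs y ys p q) = evals-∷ g gs xs y ys (f p) (f q)
Rule-map f (lookup-zero y r) = lookup-zero y r
Rule-map f (lookup-suc x r i y p) = lookup-suc x r i y (f p)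
Rule-map f code-zer = code-zer
Rule-map f code-succ = code-succ
Rule-map f (code-proj n i i<n) = code-proj n i i<n
Rule-map f (code-comp m n g gs p q) = code-comp m n g gs (f p) (f q)
Rule-map f (code-prec n g h p q) = code-prec n g h (f p) (f q)
Rule-map f (code-mu n g p) = code-mu n g (f p)
Rule-map f code-orc = code-orc
Rule-map f (codes-[] n) = codes-[] n
Rule-map f (codes-∷ g gs m n p q) = codes-∷ g gs m n (f p) (f q)

judgementT : ∀ {n} → ℕ → Tm n → Tm n → Tm n → Tm n
judgementT k a b c = pairT (lit k) (pairT a (pairT b c))

evalT evalsT lookupT codesT : ∀ {n} → Tm n → Tm n → Tm n → Tm n
evalT = judgementT 0
evalsT = judgementT 1
lookupT = judgementT 2
codesT = judgementT 4

codeT : ∀ {n} → Tm n → Tm n → Tm n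
codeT c n = judgementT 3 c n (lit 0)

zerT succT orcT : ∀ {n} → Tm n
zerT = pairT (lit 0) (lit 0)
succT = pairT (lit 1) (lit 0)
orcT = pairT (lit 6) (lit 0)

projT muT : ∀ {n} → Tm n → Tm n → Tm n
projT n i = pairT (lit 2) (pairT n i)
muT n f = pairT (lit 5) (pairT n f)

precT : ∀ {n} → Tm n → Tm n → Tm n → Tm n
precT n f g = pairT (lit 4) (pairT n (pairT f g))

compT : ∀ {n} → Tm n → Tm n → Tm n → Tm n → Tm n
compT m n f gs = pairT (lit 3) (pairT m (pairT n (pairT f gs)))

memF : ∀ {n} → Tm n → Tm n → Fm n
memF T t = appF setOfFm (T ∷ t ∷ [])

-- exs k φ binds k variables below l + T in front of the variables l and T.
exs : ∀ k → Fm (k + 2) → Fm 2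
exs zero φ = φ
exs (suc k) φ = exs k (exF (addT (var (k F.↑ʳ F.zero)) (var (k F.↑ʳ F.suc F.zero))) φ)

-- Each formula says that l is the conclusion of the corresponding rule with premises in the list T.
eval-zerᶠ eval-succᶠ eval-projᶠ eval-compᶠ eval-prec0ᶠ eval-precSᶠ eval-muᶠ eval-orcᶠ
  evals-[]ᶠ evals-∷ᶠ lookup-zeroᶠ lookup-sucᶠ code-zerᶠ code-succᶠ code-projᶠ code-compᶠ
  code-precᶠ code-muᶠ code-orcᶠ codes-[]ᶠ codes-∷ᶠ : Fm 2
eval-zerᶠ = exs 0 (eqF (v 0) (evalT zerT (lit 0) (lit 0)))
eval-succᶠ = exs 1 (eqF (v 1) (evalT succT (consT (v 0) (lit 0)) (sucT (v 0))))
eval-projᶠ = exs 4 (andF (eqF (v 4) (evalT (projT (v 0) (v 1)) (v 2) (v 3)))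
  (memF (v 5) (lookupT (v 2) (v 1) (v 3))))
eval-compᶠ = exs 7 (andF (eqF (v 7) (evalT (compT (v 0) (v 1) (v 2) (v 3)) (v 4) (v 6)))
  (andF (memF (v 8) (evalsT (v 3) (v 4) (v 5))) (memF (v 8) (evalT (v 2) (v 5) (v 6)))))
eval-prec0ᶠ = exs 5 (andF (eqF (v 5) (evalT (precT (v 0) (v 1) (v 2)) (consT (lit 0) (v 3)) (v 4)))
  (memF (v 6) (evalT (v 1) (v 3) (v 4))))
eval-precSᶠ = exs 7 (andF (eqF (v 7) (evalT (precT (v 0) (v 1) (v 2)) (consT (sucT (v 3)) (v 4)) (v 6)))
  (andF (memF (v 8) (evalT (precT (v 0) (v 1) (v 2)) (consT (v 3) (v 4)) (v 5)))
        (memF (v 8) (evalT (v 2) (consT (v 3) (consT (v 5) (v 4))) (v 6)))))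
eval-muᶠ = exs 4 (andF (eqF (v 4) (evalT (muT (v 0) (v 1)) (v 2) (v 3)))
  (andF (memF (v 5) (evalT (v 1) (consT (v 3) (v 2)) (lit 0)))
        (notF (exF (v 3) (notF (exF (addT (v 5) (v 6))
          (memF (v 7) (evalT (v 3) (consT (v 1) (v 4)) (sucT (v 0))))))))))
eval-orcᶠ = exs 1 (eqF (v 1) (evalT orcT (consT (v 0) (lit 0)) (lit 0)))
evals-[]ᶠ = exs 1 (eqF (v 1) (evalsT (lit 0) (v 0) (lit 0)))
evals-∷ᶠ = exs 5 (andF (eqF (v 5) (evalsT (consT (v 0) (v 1)) (v 2) (consT (v 3) (v 4))))
  (andF (memF (v 6) (evalT (v 0) (v 2) (v 3))) (memF (v 6) (evalsT (v 1) (v 2) (v 4)))))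
lookup-zeroᶠ = exs 2 (eqF (v 2) (lookupT (consT (v 0) (v 1)) (lit 0) (v 0)))
lookup-sucᶠ = exs 4 (andF (eqF (v 4) (lookupT (consT (v 0) (v 1)) (sucT (v 2)) (v 3)))
  (memF (v 5) (lookupT (v 1) (v 2) (v 3))))
code-zerᶠ = exs 0 (eqF (v 0) (codeT zerT (lit 0)))
code-succᶠ = exs 0 (eqF (v 0) (codeT succT (lit 1)))
code-projᶠ = exs 2 (andF (eqF (v 2) (codeT (projT (v 0) (v 1)) (v 0))) (ltF (v 1) (v 0)))
code-compᶠ = exs 4 (andF (eqF (v 4) (codeT (compT (v 0) (v 1) (v 2) (v 3)) (v 1)))
  (andF (memF (v 5) (codeT (v 2) (v 0))) (memF (v 5) (codesT (v 3) (v 0) (v 1)))))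
code-precᶠ = exs 3 (andF (eqF (v 3) (codeT (precT (v 0) (v 1) (v 2)) (sucT (v 0))))
  (andF (memF (v 4) (codeT (v 1) (v 0))) (memF (v 4) (codeT (v 2) (sucT (sucT (v 0)))))))
code-muᶠ = exs 2 (andF (eqF (v 2) (codeT (muT (v 0) (v 1)) (v 0))) (memF (v 3) (codeT (v 1) (sucT (v 0)))))
code-orcᶠ = exs 0 (eqF (v 0) (codeT orcT (lit 1)))
codes-[]ᶠ = exs 1 (eqF (v 1) (codesT (lit 0) (lit 0) (v 0)))
codes-∷ᶠ = exs 4 (andF (eqF (v 4) (codesT (consT (v 0) (v 1)) (sucT (v 2)) (v 3)))
  (andF (memF (v 5) (codeT (v 0) (v 3))) (memF (v 5) (codesT (v 1) (v 2) (v 3)))))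

ruleFms : Vec (Fm 2) 21
ruleFms = eval-zerᶠ ∷ eval-succᶠ ∷ eval-projᶠ ∷ eval-compᶠ ∷ eval-prec0ᶠ ∷ eval-precSᶠ ∷ eval-muᶠ ∷
  eval-orcᶠ ∷ evals-[]ᶠ ∷ evals-∷ᶠ ∷ lookup-zeroᶠ ∷ lookup-sucᶠ ∷ code-zerᶠ ∷ code-succᶠ ∷ code-projᶠ ∷
  code-compᶠ ∷ code-precᶠ ∷ code-muᶠ ∷ code-orcᶠ ∷ codes-[]ᶠ ∷ codes-∷ᶠ ∷ []

ruleFm : Fm 2
ruleFm = ⋁ ruleFms

Mem : ℕ → ℕ → Set
Mem T l = setOf T l ≡ true

module _ (l T : ℕ) where
  private
    cast : ∀ {l′} → l ≡ l′ → Rule (Mem T) l′ → Rule (Mem T) l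
    cast eq = subst (Rule (Mem T)) (sym eq)

  ruleFm-sound : ⟪ ruleFm ⟫ χ∅ (l ∷ T ∷ []) ≡ true → Rule (Mem T) l
  ruleFm-sound = ⋁-elim ruleFms {χ∅} {l ∷ T ∷ []}
    $ (λ eq → cast eq eval-zer)
    ∷ (λ (x , _ , eq) → cast eq (eval-succ x))
    ∷ (λ (y , _ , xs , _ , i , _ , n , _ , eq , p) → cast eq (eval-proj n i xs y p))
    ∷ (λ (y , _ , ys , _ , xs , _ , gs , _ , f , _ , n , _ , m , _ , eq , p , q) →
         cast eq (eval-comp m n f gs xs ys y p q))
    ∷ (λ (y , _ , xs , _ , g , _ , f , _ , n , _ , eq , p) → cast eq (eval-prec0 n f g xs y p))
    ∷ (λ (z , _ , y , _ , xs , _ , k , _ , g , _ , f , _ , n , _ , eq , p , q) →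
         cast eq (eval-precS n f g k xs y z p q))
    ∷ (λ (k , _ , xs , _ , f , _ , n , _ , eq , p , none) → cast eq (eval-mu n f xs k p λ j j<k →
         let (w , _ , q) = anyBelow⁻ (l + T) _ (not-false⁻ (anyBelow-false⁻ k _ none j j<k)) in w , q))
    ∷ (λ (x , _ , eq) → cast eq (eval-orc x))
    ∷ (λ (xs , _ , eq) → cast eq (evals-[] xs))
    ∷ (λ (ys , _ , y , _ , xs , _ , gs , _ , g , _ , eq , p , q) → cast eq (evals-∷ g gs xs y ys p q))
    ∷ (λ (r , _ , y , _ , eq) → cast eq (lookup-zero y r))
    ∷ (λ (y , _ , i , _ , r , _ , x , _ , eq , p) → cast eq (lookup-suc x r i y p))
    ∷ (λ eq → cast eq code-zer)
    ∷ (λ eq → cast eq code-succ)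
    ∷ (λ (i , _ , n , _ , eq , i<n) → cast eq (code-proj n i i<n))
    ∷ (λ (gs , _ , f , _ , n , _ , m , _ , eq , p , q) → cast eq (code-comp m n f gs p q))
    ∷ (λ (g , _ , f , _ , n , _ , eq , p , q) → cast eq (code-prec n f g p q))
    ∷ (λ (f , _ , n , _ , eq , p) → cast eq (code-mu n f p))
    ∷ (λ eq → cast eq code-orc)
    ∷ (λ (n , _ , eq) → cast eq (codes-[] n))
    ∷ (λ (n , _ , m , _ , gs , _ , g , _ , eq , p , q) → cast eq (codes-∷ g gs m n p q))
    ∷ []

_⊏_ : ∀ {a b c} → a < b → b < c → a < c
_⊏_ = <-trans
infixr 5 _⊏_

judgement>₁ : ∀ k a b c → a < judgement k a b c
judgement>₁ k a b c = π>fst a (π b c) ⊏ π>snd k _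

judgement>₂ : ∀ k a b c → b < judgement k a b c
judgement>₂ k a b c = π>fst b c ⊏ π>snd a (π b c) ⊏ π>snd k _

judgement>₃ : ∀ k a b c → c < judgement k a b c
judgement>₃ k a b c = π>snd b c ⊏ π>snd a (π b c) ⊏ π>snd k _

cons>head : ∀ x r → x < cons x r
cons>head x r = π>fst x r ⊏ n<1+n _

cons>tail : ∀ x r → r < cons x r
cons>tail x r = π>snd x r ⊏ n<1+n _

-- Every variable bound by exs is a component of l or of a premise in T, hence below l + T.
ruleFm-complete : ∀ {l T} → Rule (Mem T) l → ⟪ ruleFm ⟫ χ∅ (l ∷ T ∷ []) ≡ true
ruleFm-complete {l} {T} r = ⋁⁺ ruleFms {χ∅} {l ∷ T ∷ []} (complete r)
  where
  inl : ∀ {w} → w < l → w < l + T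
  inl = m≤n⇒m≤n+o T
  inT : ∀ {w} → w < T → w < l + T
  inT = m≤n⇒m≤o+n l
  prem : ∀ {l′} → Mem T l′ → l′ < T
  prem = setOf-bounded T _
  e₁ = judgement>₁ 0
  e₂ = judgement>₂ 0
  e₃ = judgement>₃ 0
  c₁ = judgement>₁ 3
  c₂ = judgement>₂ 3
  complete : Rule (Mem T) l → ∃ λ i → Holds (lookup ruleFms i) χ∅ (l ∷ T ∷ [])
  complete eval-zer = # 0 , refl
  complete (eval-succ x) = # 1 , x , inl (cons>head x 0 ⊏ e₂ _ _ _) , refl
  complete (eval-proj n i xs y p) = # 2 ,
    y , inl (e₃ _ _ _) , xs , inl (e₂ _ _ _) , i , inl (π>snd n i ⊏ π>snd 2 _ ⊏ e₁ _ _ _) ,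
    n , inl (π>fst n i ⊏ π>snd 2 _ ⊏ e₁ _ _ _) , refl , p
  complete (eval-comp m n f gs xs ys y p q) = # 3 ,
    y , inl (e₃ _ _ _) , ys , inT (judgement>₃ 1 gs xs ys ⊏ prem p) , xs , inl (e₂ _ _ _) ,
    gs , inl (π>snd f gs ⊏ π>snd n _ ⊏ π>snd m _ ⊏ π>snd 3 _ ⊏ e₁ _ _ _) ,
    f , inl (π>fst f gs ⊏ π>snd n _ ⊏ π>snd m _ ⊏ π>snd 3 _ ⊏ e₁ _ _ _) ,
    n , inl (π>fst n _ ⊏ π>snd m _ ⊏ π>snd 3 _ ⊏ e₁ _ _ _) ,
    m , inl (π>fst m _ ⊏ π>snd 3 _ ⊏ e₁ _ _ _) , refl , p , q
  complete (eval-prec0 n f g xs y p) = # 4 ,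
    y , inl (e₃ _ _ _) , xs , inl (cons>tail 0 xs ⊏ e₂ _ _ _) ,
    g , inl (π>snd f g ⊏ π>snd n _ ⊏ π>snd 4 _ ⊏ e₁ _ _ _) ,
    f , inl (π>fst f g ⊏ π>snd n _ ⊏ π>snd 4 _ ⊏ e₁ _ _ _) ,
    n , inl (π>fst n _ ⊏ π>snd 4 _ ⊏ e₁ _ _ _) , refl , p
  complete (eval-precS n f g k xs y z p q) = # 5 ,
    z , inl (e₃ _ _ _) , y , inT (e₃ _ _ _ ⊏ prem p) , xs , inl (cons>tail (suc k) xs ⊏ e₂ _ _ _) ,
    k , inl (n<1+n k ⊏ cons>head (suc k) xs ⊏ e₂ _ _ _) ,
    g , inl (π>snd f g ⊏ π>snd n _ ⊏ π>snd 4 _ ⊏ e₁ _ _ _) ,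
    f , inl (π>fst f g ⊏ π>snd n _ ⊏ π>snd 4 _ ⊏ e₁ _ _ _) ,
    n , inl (π>fst n _ ⊏ π>snd 4 _ ⊏ e₁ _ _ _) , refl , p , q
  complete (eval-mu n f xs k p ps) = # 6 ,
    k , inl (e₃ _ _ _) , xs , inl (e₂ _ _ _) , f , inl (π>snd n f ⊏ π>snd 5 _ ⊏ e₁ _ _ _) ,
    n , inl (π>fst n f ⊏ π>snd 5 _ ⊏ e₁ _ _ _) , refl , p ,
    anyBelow-false⁺ k _ λ j j<k → let (w , q) = ps j j<k in
      not-false⁺ (anyBelow⁺ (l + T) _ w (inT (n<1+n w ⊏ e₃ _ _ _ ⊏ prem q)) q)
  complete (eval-orc x) = # 7 , x , inl (cons>head x 0 ⊏ e₂ _ _ _) , refl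
  complete (evals-[] xs) = # 8 , xs , inl (judgement>₂ 1 _ _ _) , refl
  complete (evals-∷ g gs xs y ys p q) = # 9 ,
    ys , inl (cons>tail y ys ⊏ judgement>₃ 1 _ _ _) , y , inl (cons>head y ys ⊏ judgement>₃ 1 _ _ _) ,
    xs , inl (judgement>₂ 1 _ _ _) , gs , inl (cons>tail g gs ⊏ judgement>₁ 1 _ _ _) ,
    g , inl (cons>head g gs ⊏ judgement>₁ 1 _ _ _) , refl , p , q
  complete (lookup-zero y r) = # 10 ,
    r , inl (cons>tail y r ⊏ judgement>₁ 2 _ _ _) , y , inl (cons>head y r ⊏ judgement>₁ 2 _ _ _) , refl
  complete (lookup-suc x r i y p) = # 11 ,
    y , inl (judgement>₃ 2 _ _ _) , i , inl (n<1+n i ⊏ judgement>₂ 2 _ _ _) ,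
    r , inl (cons>tail x r ⊏ judgement>₁ 2 _ _ _) , x , inl (cons>head x r ⊏ judgement>₁ 2 _ _ _) , refl , p
  complete code-zer = # 12 , refl
  complete code-succ = # 13 , refl
  complete (code-proj n i i<n) = # 14 ,
    i , inl (π>snd n i ⊏ π>snd 2 _ ⊏ c₁ _ _ _) , n , inl (π>fst n i ⊏ π>snd 2 _ ⊏ c₁ _ _ _) , refl , i<n
  complete (code-comp m n f gs p q) = # 15 ,
    gs , inl (π>snd f gs ⊏ π>snd n _ ⊏ π>snd m _ ⊏ π>snd 3 _ ⊏ c₁ _ _ _) ,
    f , inl (π>fst f gs ⊏ π>snd n _ ⊏ π>snd m _ ⊏ π>snd 3 _ ⊏ c₁ _ _ _) ,
    n , inl (π>fst n _ ⊏ π>snd m _ ⊏ π>snd 3 _ ⊏ c₁ _ _ _) ,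
    m , inl (π>fst m _ ⊏ π>snd 3 _ ⊏ c₁ _ _ _) , refl , p , q
  complete (code-prec n f g p q) = # 16 ,
    g , inl (π>snd f g ⊏ π>snd n _ ⊏ π>snd 4 _ ⊏ c₁ _ _ _) ,
    f , inl (π>fst f g ⊏ π>snd n _ ⊏ π>snd 4 _ ⊏ c₁ _ _ _) ,
    n , inl (π>fst n _ ⊏ π>snd 4 _ ⊏ c₁ _ _ _) , refl , p , q
  complete (code-mu n f p) = # 17 ,
    f , inl (π>snd n f ⊏ π>snd 5 _ ⊏ c₁ _ _ _) , n , inl (π>fst n f ⊏ π>snd 5 _ ⊏ c₁ _ _ _) , refl , p
  complete code-orc = # 18 , refl
  complete (codes-[] n) = # 19 , n , inl (judgement>₃ 4 _ _ _) , refl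
  complete (codes-∷ g gs m n p q) = # 20 ,
    n , inl (judgement>₃ 4 _ _ _) , m , inl (n<1+n m ⊏ judgement>₂ 4 _ _ _) ,
    gs , inl (cons>tail g gs ⊏ judgement>₁ 4 _ _ _) , g , inl (cons>head g gs ⊏ judgement>₁ 4 _ _ _) ,
    refl , p , q

open Valid ruleFm

-- Opaque for the same reason as π.
opaque
  cd : ∀ {n} → Code n → ℕ
  cd = ⌜_⌝

  cdv : ∀ {m n} → Vec (Code n) m → ℕ
  cdv = ⌜_⌝v

opaque
  unfolding cd cdv π

  cd≡⌜⌝ : ∀ {n} (d : Code n) → cd d ≡ ⌜ d ⌝
  cd≡⌜⌝ d = refl

  cd-zer : cd zer ≡ zerN
  cd-zer = refl

  cd-succ : cd succ ≡ succN
  cd-succ = refl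

  cd-proj : ∀ {n} (i : Fin n) → cd (proj i) ≡ projN n (toℕ i)
  cd-proj i = refl

  cd-comp : ∀ {m n} (f : Code m) (gs : Vec (Code n) m) → cd (comp f gs) ≡ compN m n (cd f) (cdv gs)
  cd-comp f gs = refl

  cd-prec : ∀ {n} (f : Code n) (g : Code (suc (suc n))) → cd (prec f g) ≡ precN n (cd f) (cd g)
  cd-prec f g = refl

  cd-mu : ∀ {n} (f : Code (suc n)) → cd (mu f) ≡ muN n (cd f)
  cd-mu f = refl

  cd-orc : cd orc ≡ orcN
  cd-orc = refl

  cdv-[] : ∀ {n} → cdv {0} {n} [] ≡ 0
  cdv-[] = refl

  cdv-∷ : ∀ {m n} (g : Code n) (gs : Vec (Code n) m) → cdv (g ∷ gs) ≡ cons (cd g) (cdv gs)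
  cdv-∷ g gs = refl

tag : ∀ {n} → Code n → ℕ
tag zer = 0
tag succ = 1
tag (proj _) = 2
tag (comp _ _) = 3
tag (prec _ _) = 4
tag (mu _) = 5
tag orc = 6

cd-tag : ∀ {n} (d : Code n) → ∃ λ b → cd d ≡ π (tag d) b
cd-tag zer = _ , cd-zer
cd-tag succ = _ , cd-succ
cd-tag (proj i) = _ , cd-proj i
cd-tag (comp f gs) = _ , cd-comp f gs
cd-tag (prec f g) = _ , cd-prec f g
cd-tag (mu f) = _ , cd-mu f
cd-tag orc = _ , cd-orc

mismatch : ∀ {X : Set} {n} (d : Code n) {k b} {_ : False (tag d ≟ k)} → cd d ≡ π k b → X
mismatch d {_} {_} {ne} e with _ , e′ ← cd-tag d =
  ⊥-elim (toWitnessFalse ne (proj₁ (π-injective (trans (sym e′) e))))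

judgement-injective : ∀ {k a b c k′ a′ b′ c′} → judgement k a b c ≡ judgement k′ a′ b′ c′ →
  k ≡ k′ × a ≡ a′ × b ≡ b′ × c ≡ c′
judgement-injective e with refl , e₁ ← π-injective e with refl , e₂ ← π-injective e₁
  with refl , refl ← π-injective e₂ = refl , refl , refl , refl

cons-injective : ∀ {x r x′ r′} → cons x r ≡ cons x′ r′ → x ≡ x′ × r ≡ r′
cons-injective e = π-injective (suc-injective e)

-- What each judgement asserts about all programs and inputs with the given codes; tags beyond 4
-- are never derived.
Meaning : ℕ → ℕ → ℕ → ℕ → Set
Meaning 0 c xs y = ∀ n (d : Code n) (v : Vec ℕ n) → cd d ≡ c → encV v ≡ xs → Eval ∅ d v y
Meaning 1 gs xs ys = ∀ n m (ds : Vec (Code n) m) (v : Vec ℕ n) → cdv ds ≡ gs → encV v ≡ xs →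
  ∃ λ ws → encV ws ≡ ys × EvalVec ∅ ds v ws
Meaning 2 xs i y = ∀ n (v : Vec ℕ n) (j : Fin n) → encV v ≡ xs → toℕ j ≡ i → lookup v j ≡ y
Meaning 3 c n _ = ∃ λ (d : Code n) → cd d ≡ c
Meaning 4 gs m n = ∃ λ (ds : Vec (Code n) m) → cdv ds ≡ gs
Meaning _ _ _ _ = ⊤

Sound : ℕ → Set
Sound l = ∀ k a b c → l ≡ judgement k a b c → Meaning k a b c

prec-codes-injective : ∀ {n′ n f g} (f′ : Code n′) (g′ : Code (suc (suc n′))) →
  cd (prec f′ g′) ≡ precN n f g → cd f′ ≡ f × cd g′ ≡ g
prec-codes-injective f′ g′ e = π-injective (proj₂ (π-injective (proj₂ (π-injective (trans (sym (cd-prec f′ g′)) e)))))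

eval-zer-sound : Meaning 0 zerN 0 0
eval-zer-sound _ zer [] _ _ = ev-zer
eval-zer-sound _ succ _ e _ = mismatch succ e
eval-zer-sound _ (proj i) _ e _ = mismatch (proj i) e
eval-zer-sound _ (comp f gs) _ e _ = mismatch (comp f gs) e
eval-zer-sound _ (prec f g) _ e _ = mismatch (prec f g) e
eval-zer-sound _ (mu f) _ e _ = mismatch (mu f) e
eval-zer-sound _ orc _ e _ = mismatch orc e

eval-succ-sound : ∀ x → Meaning 0 succN (cons x 0) (suc x)
eval-succ-sound x _ zer _ e _ = mismatch zer e
eval-succ-sound x _ succ (x′ ∷ []) _ ev with refl , _ ← cons-injective ev = ev-succ x′
eval-succ-sound x _ (proj i) _ e _ = mismatch (proj i) e
eval-succ-sound x _ (comp f gs) _ e _ = mismatch (comp f gs) e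
eval-succ-sound x _ (prec f g) _ e _ = mismatch (prec f g) e
eval-succ-sound x _ (mu f) _ e _ = mismatch (mu f) e
eval-succ-sound x _ orc _ e _ = mismatch orc e

eval-proj-sound : ∀ n i xs y → Meaning 2 xs i y → Meaning 0 (projN n i) xs y
eval-proj-sound n i xs y h _ zer _ e _ = mismatch zer e
eval-proj-sound n i xs y h _ succ _ e _ = mismatch succ e
eval-proj-sound n i xs y h _ (proj j) v e ev =
  subst (Eval ∅ (proj j) v) (h _ v j ev (proj₂ (π-injective (proj₂ (π-injective (trans (sym (cd-proj j)) e)))))) (ev-proj j v)
eval-proj-sound n i xs y h _ (comp f gs) _ e _ = mismatch (comp f gs) e
eval-proj-sound n i xs y h _ (prec f g) _ e _ = mismatch (prec f g) e
eval-proj-sound n i xs y h _ (mu f) _ e _ = mismatch (mu f) e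
eval-proj-sound n i xs y h _ orc _ e _ = mismatch orc e

eval-comp-sound : ∀ m n f gs xs ys y → Meaning 1 gs xs ys → Meaning 0 f ys y →
  Meaning 0 (compN m n f gs) xs y
eval-comp-sound m n f gs xs ys y hs hf _ zer _ e _ = mismatch zer e
eval-comp-sound m n f gs xs ys y hs hf _ succ _ e _ = mismatch succ e
eval-comp-sound m n f gs xs ys y hs hf _ (proj i) _ e _ = mismatch (proj i) e
eval-comp-sound m n f gs xs ys y hs hf _ (comp f′ gs′) v e ev
  with _ , refl , refl , e′ ← judgement-injective (trans (sym (cd-comp f′ gs′)) e) =
  let (ef , egs) = π-injective e′
      (ws , ew , evs) = hs _ _ gs′ v egs ev
  in ev-comp evs (hf _ f′ ws ef ew)
eval-comp-sound m n f gs xs ys y hs hf _ (prec f′ g) _ e _ = mismatch (prec f′ g) e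
eval-comp-sound m n f gs xs ys y hs hf _ (mu f′) _ e _ = mismatch (mu f′) e
eval-comp-sound m n f gs xs ys y hs hf _ orc _ e _ = mismatch orc e

eval-prec0-sound : ∀ n f g xs y → Meaning 0 f xs y → Meaning 0 (precN n f g) (cons 0 xs) y
eval-prec0-sound n f g xs y h _ zer _ e _ = mismatch zer e
eval-prec0-sound n f g xs y h _ succ _ e _ = mismatch succ e
eval-prec0-sound n f g xs y h _ (proj i) _ e _ = mismatch (proj i) e
eval-prec0-sound n f g xs y h _ (comp f′ gs) _ e _ = mismatch (comp f′ gs) e
eval-prec0-sound n f g xs y h _ (prec f′ g′) (x ∷ v) e ev with refl , ev′ ← cons-injective ev =
  ev-prec0 (h _ f′ v (proj₁ (prec-codes-injective f′ g′ e)) ev′)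
eval-prec0-sound n f g xs y h _ (mu f′) _ e _ = mismatch (mu f′) e
eval-prec0-sound n f g xs y h _ orc _ e _ = mismatch orc e

eval-precS-sound : ∀ n f g k xs y z → Meaning 0 (precN n f g) (cons k xs) y →
  Meaning 0 g (cons k (cons y xs)) z → Meaning 0 (precN n f g) (cons (suc k) xs) z
eval-precS-sound n f g k xs y z hk hg _ zer _ e _ = mismatch zer e
eval-precS-sound n f g k xs y z hk hg _ succ _ e _ = mismatch succ e
eval-precS-sound n f g k xs y z hk hg _ (proj i) _ e _ = mismatch (proj i) e
eval-precS-sound n f g k xs y z hk hg _ (comp f′ gs) _ e _ = mismatch (comp f′ gs) e
eval-precS-sound n f g k xs y z hk hg _ (prec f′ g′) (x ∷ v) e ev with refl , ev′ ← cons-injective ev =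
  ev-precS (hk _ (prec f′ g′) (k ∷ v) e (cong (cons k) ev′))
           (hg _ g′ (k ∷ y ∷ v) (proj₂ (prec-codes-injective f′ g′ e)) (cong (cons k) (cong (cons y) ev′)))
eval-precS-sound n f g k xs y z hk hg _ (mu f′) _ e _ = mismatch (mu f′) e
eval-precS-sound n f g k xs y z hk hg _ orc _ e _ = mismatch orc e

eval-mu-sound : ∀ n f xs k → Meaning 0 f (cons k xs) 0 →
  (∀ j → j < k → ∃ λ w → Meaning 0 f (cons j xs) (suc w)) → Meaning 0 (muN n f) xs k
eval-mu-sound n f xs k h0 hs _ zer _ e _ = mismatch zer e
eval-mu-sound n f xs k h0 hs _ succ _ e _ = mismatch succ e
eval-mu-sound n f xs k h0 hs _ (proj i) _ e _ = mismatch (proj i) e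
eval-mu-sound n f xs k h0 hs _ (comp f′ gs) _ e _ = mismatch (comp f′ gs) e
eval-mu-sound n f xs k h0 hs _ (prec f′ g) _ e _ = mismatch (prec f′ g) e
eval-mu-sound n f xs k h0 hs _ (mu f′) v e ev =
  ev-mu (h0 _ f′ (k ∷ v) ef (cong (cons k) ev)) λ j j<k →
    let (w , hw) = hs j j<k in w , hw _ f′ (j ∷ v) ef (cong (cons j) ev)
  where
  ef : cd f′ ≡ f
  ef = proj₂ (π-injective (proj₂ (π-injective (trans (sym (cd-mu f′)) e))))
eval-mu-sound n f xs k h0 hs _ orc _ e _ = mismatch orc e

eval-orc-sound : ∀ x → Meaning 0 orcN (cons x 0) 0
eval-orc-sound x _ zer _ e _ = mismatch zer e
eval-orc-sound x _ succ _ e _ = mismatch succ e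
eval-orc-sound x _ (proj i) _ e _ = mismatch (proj i) e
eval-orc-sound x _ (comp f gs) _ e _ = mismatch (comp f gs) e
eval-orc-sound x _ (prec f g) _ e _ = mismatch (prec f g) e
eval-orc-sound x _ (mu f) _ e _ = mismatch (mu f) e
eval-orc-sound x _ orc (_ ∷ []) _ _ = ev-orc0 λ ()

evals-[]-sound : ∀ xs → Meaning 1 0 xs 0
evals-[]-sound xs _ _ [] v e ev = [] , refl , ev-[]
evals-[]-sound xs _ _ (d ∷ ds) v e ev = ⊥-elim (0≢1+n (trans (sym e) (cdv-∷ d ds)))

evals-∷-sound : ∀ g gs xs y ys → Meaning 0 g xs y → Meaning 1 gs xs ys →
  Meaning 1 (cons g gs) xs (cons y ys)
evals-∷-sound g gs xs y ys hg hs _ _ [] v e ev = ⊥-elim (0≢1+n (trans (sym cdv-[]) e))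
evals-∷-sound g gs xs y ys hg hs _ _ (d ∷ ds) v e ev =
  let (eg , egs) = cons-injective (trans (sym (cdv-∷ d ds)) e)
      (ws , ew , evs) = hs _ _ ds v egs ev
  in y ∷ ws , cong (cons y) ew , ev-∷ (hg _ d v eg ev) evs

lookup-zero-sound : ∀ y r → Meaning 2 (cons y r) 0 y
lookup-zero-sound y r _ (x ∷ v) F.zero e _ = proj₁ (cons-injective e)

lookup-suc-sound : ∀ x r i y → Meaning 2 r i y → Meaning 2 (cons x r) (suc i) y
lookup-suc-sound x r i y h _ (x′ ∷ v) (F.suc j) e ej = h _ v j (proj₂ (cons-injective e)) (suc-injective ej)

Rule-sound : ∀ {M l} → Rule M l → (∀ l′ → M l′ → Sound l′) → Sound l
Rule-sound {M} r ih = sound r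
  where
  at : ∀ {k a b c} → Meaning k a b c → Sound (judgement k a b c)
  at m _ _ _ _ e with refl , refl , refl , refl ← judgement-injective e = m
  use : ∀ {k a b c} → M (judgement k a b c) → Meaning k a b c
  use p = ih _ p _ _ _ _ refl
  sound : ∀ {l} → Rule M l → Sound l
  sound eval-zer = at eval-zer-sound
  sound (eval-succ x) = at (eval-succ-sound x)
  sound (eval-proj n i xs y p) = at (eval-proj-sound n i xs y (use p))
  sound (eval-comp m n f gs xs ys y p q) = at (eval-comp-sound m n f gs xs ys y (use p) (use q))
  sound (eval-prec0 n f g xs y p) = at (eval-prec0-sound n f g xs y (use p))
  sound (eval-precS n f g k xs y z p q) = at (eval-precS-sound n f g k xs y z (use p) (use q))
  sound (eval-mu n f xs k p ps) =
    at (eval-mu-sound n f xs k (use p) λ j j<k → let (w , q) = ps j j<k in w , use q)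
  sound (eval-orc x) = at (eval-orc-sound x)
  sound (evals-[] xs) = at (evals-[]-sound xs)
  sound (evals-∷ g gs xs y ys p q) = at (evals-∷-sound g gs xs y ys (use p) (use q))
  sound (lookup-zero y r) = at (lookup-zero-sound y r)
  sound (lookup-suc x r i y p) = at (lookup-suc-sound x r i y (use p))
  sound code-zer = at (zer , cd-zer)
  sound code-succ = at (succ , cd-succ)
  sound (code-proj n i i<n) = at (proj (fromℕ< i<n) , trans (cd-proj _) (cong (projN n) (toℕ-fromℕ< i<n)))
  sound (code-comp m n f gs p q) =
    let (df , ef) = use p ; (ds , es) = use q
    in at (comp df ds , trans (cd-comp df ds) (cong₂ (compN m n) ef es))
  sound (code-prec n f g p q) =
    let (df , ef) = use p ; (dg , eg) = use q
    in at (prec df dg , trans (cd-prec df dg) (cong₂ (precN n) ef eg))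
  sound (code-mu n f p) = let (df , ef) = use p in at (mu df , trans (cd-mu df) (cong (muN n) ef))
  sound code-orc = at (orc , cd-orc)
  sound (codes-[] n) = at ([] , cdv-[])
  sound (codes-∷ g gs m n p q) =
    let (dg , eg) = use p ; (ds , es) = use q
    in at (dg ∷ ds , trans (cdv-∷ dg ds) (cong₂ cons eg es))

valid⇒sound : ∀ L → valid L ≡ true → ∀ l → Mem L l → Sound l
valid⇒sound = <-rec _ step
  where
  step : ∀ L → (∀ {L′} → L′ < L → valid L′ ≡ true → ∀ l → Mem L′ l → Sound l) →
         valid L ≡ true → ∀ l → Mem L l → Sound l
  step L rec vL l m with π-surjective L (≤-<-trans z≤n (setOf-bounded L l m))
  ... | x , r , refl with valid-π⁻ x r vL | setOf-π⁻ x r l m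
  ...   | _ , vr | inj₂ mr = rec (π>snd x r) vr l mr
  ...   | rx , vr | inj₁ refl = Rule-sound (ruleFm-sound x r rx) λ l′ → rec (π>snd x r) vr l′

encList : List ℕ → ℕ
encList [] = 0
encList (x ∷ xs) = π x (encList xs)

data Derivation : List ℕ → Set where
  []ᵈ : Derivation []
  _∷ᵈ_ : ∀ {x xs} → Rule (_∈ xs) x → Derivation xs → Derivation (x ∷ xs)

setOf-encList : ∀ {l xs} → l ∈ xs → Mem (encList xs) l
setOf-encList {xs = x ∷ xs} (here refl) = setOf-π⁺ x (encList xs) _ (inj₁ refl)
setOf-encList {xs = x ∷ xs} (there p) = setOf-π⁺ x (encList xs) _ (inj₂ (setOf-encList p))

Derivation⇒valid : ∀ {xs} → Derivation xs → valid (encList xs) ≡ true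
Derivation⇒valid []ᵈ = refl
Derivation⇒valid {x ∷ xs} (r ∷ᵈ d) =
  valid-π⁺ x (encList xs) (ruleFm-complete (Rule-map setOf-encList r)) (Derivation⇒valid d)

Derivation-++ : ∀ {xs ys} → Derivation xs → Derivation ys → Derivation (xs ++ᴸ ys)
Derivation-++ []ᵈ dy = dy
Derivation-++ (r ∷ᵈ dx) dy = Rule-map ∈-++⁺ˡ r ∷ᵈ Derivation-++ dx dy

Derived : Set
Derived = Σ (List ℕ) Derivation

Certificate : ℕ → Set
Certificate l = Σ Derived λ D → l ∈ proj₁ D

_⊕_ : Derived → Derived → Derived
(xs , dx) ⊕ (ys , dy) = xs ++ᴸ ys , Derivation-++ dx dy

derive : ∀ (D : Derived) {l} → Rule (_∈ proj₁ D) l → Certificate l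
derive (xs , dx) r = (_ ∷ xs , r ∷ᵈ dx) , here refl

derive₀ : ∀ {l} → Rule (_∈ []) l → Certificate l
derive₀ = derive ([] , []ᵈ)

derive₁ : ∀ {l l₁} → Certificate l₁ → (∀ {xs} → l₁ ∈ xs → Rule (_∈ xs) l) → Certificate l
derive₁ (D , p) k = derive D (k p)

derive₂ : ∀ {l l₁ l₂} → Certificate l₁ → Certificate l₂ →
  (∀ {xs} → l₁ ∈ xs → l₂ ∈ xs → Rule (_∈ xs) l) → Certificate l
derive₂ (D₁ , p₁) (D₂ , p₂) k = derive (D₁ ⊕ D₂) (k (∈-++⁺ˡ p₁) (∈-++⁺ʳ (proj₁ D₁) p₂))

deriveAll : ∀ (J : ℕ → ℕ → ℕ) k → (∀ j → j < k → ∃ λ w → Certificate (J j w)) →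
  Σ Derived λ D → ∀ j → j < k → ∃ λ w → J j w ∈ proj₁ D
deriveAll J zero _ = ([] , []ᵈ) , λ _ ()
deriveAll J (suc k) cs =
  let (D , ps) = deriveAll J k (λ j j<k → cs j (m≤n⇒m≤1+n j<k))
      (w , D′ , p) = cs k ≤-refl
  in D ⊕ D′ , λ j j<1+k → [ (λ j<k → let (w′ , q) = ps j j<k in w′ , ∈-++⁺ˡ q)
                          , (λ j≡k → w , subst (λ i → J i w ∈ _) (sym j≡k) (∈-++⁺ʳ (proj₁ D) p)) ]′
                          (m<1+n⇒m<n∨m≡n j<1+k)

certify-lookup : ∀ {n} (v : Vec ℕ n) (j : Fin n) → Certificate (lookupJ (encV v) (toℕ j) (lookup v j))
certify-lookup (x ∷ v) F.zero = derive₀ (lookup-zero x (encV v))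
certify-lookup (x ∷ v) (F.suc j) = derive₁ (certify-lookup v j) (lookup-suc x (encV v) (toℕ j) (lookup v j))

mutual
  certify-eval : ∀ {n} {d : Code n} {v y} → Eval ∅ d v y → Certificate (evalJ (cd d) (encV v) y)
  certify-eval ev-zer rewrite cd-zer = derive₀ eval-zer
  certify-eval (ev-succ x) rewrite cd-succ = derive₀ (eval-succ x)
  certify-eval (ev-proj i xs) rewrite cd-proj i = derive₁ (certify-lookup xs i) (eval-proj _ _ _ _)
  certify-eval (ev-comp {f = f} {gs} evs e) rewrite cd-comp f gs =
    derive₂ (certify-evals evs) (certify-eval e) (eval-comp _ _ _ _ _ _ _)
  certify-eval (ev-prec0 {f = f} {g} e) rewrite cd-prec f g = derive₁ (certify-eval e) (eval-prec0 _ _ _ _ _)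
  certify-eval (ev-precS {f = f} {g} e₁ e₂) rewrite cd-prec f g =
    derive₂ (subst (λ c → Certificate (evalJ c _ _)) (cd-prec f g) (certify-eval e₁)) (certify-eval e₂)
      (eval-precS _ _ _ _ _ _ _)
  certify-eval (ev-mu {f = f} {xs} {k} e ps) rewrite cd-mu f =
    let (D₀ , p₀) = certify-eval e
        (D , qs) = deriveAll (λ j w → evalJ (cd f) (cons j (encV xs)) (suc w)) k
                     λ j j<k → let (w , ev) = ps j j<k in w , certify-eval ev
    in derive (D₀ ⊕ D) (eval-mu _ _ _ _ (∈-++⁺ˡ p₀) λ j j<k →
         let (w , q) = qs j j<k in w , ∈-++⁺ʳ (proj₁ D₀) q)
  certify-eval (ev-orc1 ())
  certify-eval (ev-orc0 {x} _) rewrite cd-orc = derive₀ (eval-orc x)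

  certify-evals : ∀ {n m} {ds : Vec (Code n) m} {v ws} → EvalVec ∅ ds v ws →
    Certificate (evalsJ (cdv ds) (encV v) (encV ws))
  certify-evals {n} {v = v} ev-[] rewrite cdv-[] {n} = derive₀ (evals-[] (encV v))
  certify-evals (ev-∷ {g = g} {gs} e es) rewrite cdv-∷ g gs =
    derive₂ (certify-eval e) (certify-evals es) (evals-∷ _ _ _ _ _)

mutual
  certify-code : ∀ {n} (d : Code n) → Certificate (codeJ (cd d) n)
  certify-code zer rewrite cd-zer = derive₀ code-zer
  certify-code succ rewrite cd-succ = derive₀ code-succ
  certify-code (proj i) rewrite cd-proj i = derive₀ (code-proj _ _ (toℕ<n i))
  certify-code (comp f gs) rewrite cd-comp f gs =
    derive₂ (certify-code f) (certify-codes gs) (code-comp _ _ _ _)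
  certify-code (prec f g) rewrite cd-prec f g = derive₂ (certify-code f) (certify-code g) (code-prec _ _ _)
  certify-code (mu f) rewrite cd-mu f = derive₁ (certify-code f) (code-mu _ _)
  certify-code orc rewrite cd-orc = derive₀ code-orc

  certify-codes : ∀ {m n} (ds : Vec (Code n) m) → Certificate (codesJ (cdv ds) m n)
  certify-codes {n = n} [] rewrite cdv-[] {n} = derive₀ (codes-[] n)
  certify-codes (d ∷ ds) rewrite cdv-∷ d ds = derive₂ (certify-code d) (certify-codes ds) (codes-∷ _ _ _ _)

-- The stages of K

-- e ∈ stage i when e < i and some valid list L < i records that e codes a unary program
-- which outputs some y < i on input e.
stageFm : Fm 2
stageFm = andF (ltF (v 1) (v 0)) (exF (v 0) (andF (appF (validFm ruleFm) (v 0 ∷ []))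
  (exF (v 1) (andF (memF (v 1) (evalT (v 3) (consT (v 3) (lit 0)) (v 0))) (memF (v 1) (codeT (v 3) (lit 1)))))))

stage : ℕ → ℕ → Bool
stage i e = ⟪ stageFm ⟫ χ∅ (i ∷ e ∷ [])

stage-bounded : ∀ i e → stage i e ≡ true → e < i
stage-bounded i e s = proj₁ (true⇒Holds stageFm χ∅ (i ∷ e ∷ []) s)

stage⇒K : ∀ i e → stage i e ≡ true → K e
stage⇒K i e s with _ , L , _ , vL , y , _ , halts , isCode ← true⇒Holds stageFm χ∅ (i ∷ e ∷ []) s
  with d , de ← valid⇒sound L vL _ isCode 3 e 1 0 refl =
  d , trans (sym (cd≡⌜⌝ d)) de , y , valid⇒sound L vL _ halts 0 e (cons e 0) y refl 1 d (e ∷ []) de refl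

K⇒stage : ∀ e → K e → ∃ λ N → ∀ i → N ≤ i → stage i e ≡ true
K⇒stage e (c , ce , y , ev) =
  let ce′ = trans (cd≡⌜⌝ c) ce
      (D₁ , p₁) = certify-eval ev
      (D₂ , p₂) = certify-code c
      (xs , d) = D₁ ⊕ D₂
      L = encList xs
  in suc (e + L + y) , λ i N≤i → Holds⇒true stageFm χ∅ (i ∷ e ∷ [])
       ( <-≤-trans (s≤s (≤-trans (m≤m+n e L) (m≤m+n (e + L) y))) N≤i
       , L , <-≤-trans (s≤s (≤-trans (m≤n+m L e) (m≤m+n (e + L) y))) N≤i
       , Derivation⇒valid d
       , y , <-≤-trans (s≤s (m≤n+m y (e + L))) N≤i
       , subst (λ c → Mem L (evalJ c (cons e 0) y)) ce′ (setOf-encList (∈-++⁺ˡ p₁))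
       , subst (λ c → Mem L (codeJ c 1)) ce′ (setOf-encList (∈-++⁺ʳ (proj₁ D₁) p₂)) )

addConst : ℕ → Code 1
addConst zero = proj F.zero
addConst (suc k) = comp succ (addConst k ∷ [])

addConst-eval : ∀ k x → Eval ∅ (addConst k) (x ∷ []) (k + x)
addConst-eval zero x = ev-proj F.zero (x ∷ [])
addConst-eval (suc k) x = ev-comp (ev-∷ (addConst-eval k x) ev-[]) (ev-succ (k + x))

addConst-code : ∀ k → k ≤ cd (addConst k)
addConst-code zero = z≤n
addConst-code (suc k) rewrite cd-comp succ (addConst k ∷ []) | cdv-∷ (addConst k) [] =
  ≤-<-trans (addConst-code k) (cons>head _ _ ⊏ π>snd _ _ ⊏ π>snd _ _ ⊏ π>snd _ _ ⊏ π>snd _ _)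

K-unbounded : ∀ b → ∃ λ e → b ≤ e × K e
K-unbounded b = cd (addConst b) , addConst-code b , addConst b , sym (cd≡⌜⌝ _) , _ , addConst-eval b _

-- The lexicographic order

_≺_ : (ℕ → Bool) → (ℕ → Bool) → Set
A ≺ B = ∃ λ p → (∀ q → q < p → A q ≡ B q) × A p ≡ false × B p ≡ true

≺-asym : ∀ {A B} → A ≺ B → ¬ B ≺ A
≺-asym (p , agree , Ap , Bp) (p′ , agree′ , Bp′ , Ap′) with <-cmp p p′
... | tri< p<p′ _ _ = true≢false (trans (sym (agree′ p p<p′)) Bp) Ap
... | tri≈ _ refl _ = true≢false Bp Bp′
... | tri> _ _ p′<p = true≢false (trans (sym (agree p′ p′<p)) Ap′) Bp′

≺-trans : ∀ {A B C} → A ≺ B → B ≺ C → A ≺ C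
≺-trans (p , agree , Ap , Bp) (p′ , agree′ , Bp′ , Cp′) with <-cmp p p′
... | tri< p<p′ _ _ =
  p , (λ q q<p → trans (agree q q<p) (agree′ q (<-trans q<p p<p′))) , Ap , trans (sym (agree′ p p<p′)) Bp
... | tri≈ _ refl _ = ⊥-elim (true≢false Bp Bp′)
... | tri> _ _ p′<p =
  p′ , (λ q q<p′ → trans (agree q (<-trans q<p′ p′<p)) (agree′ q q<p′)) , trans (agree p′ p′<p) Bp′ , Cp′

FirstDiff : (ℕ → Bool) → (ℕ → Bool) → ℕ → Set
FirstDiff A B p = (∀ q → q < p → A q ≡ B q) × A p ≢ B p

FirstDiff-sym : ∀ {A B p} → FirstDiff A B p → FirstDiff B A p
FirstDiff-sym (agree , ne) = (λ q q<p → sym (agree q q<p)) , ne ∘ sym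

FirstDiff-congʳ : ∀ {A B B′ p} → FirstDiff A B p → (∀ q → q ≤ p → B q ≡ B′ q) → FirstDiff A B′ p
FirstDiff-congʳ (agree , ne) eq = (λ q q<p → trans (agree q q<p) (eq q (<⇒≤ q<p))) , λ e → ne (trans e (sym (eq _ ≤-refl)))

agree-or-firstDiff : ∀ A B n → (∀ q → q < n → A q ≡ B q) ⊎ ∃ λ p → p < n × FirstDiff A B p
agree-or-firstDiff A B zero = inj₁ λ _ ()
agree-or-firstDiff A B (suc n) with agree-or-firstDiff A B n
... | inj₂ (p , p<n , fd) = inj₂ (p , m<n⇒m<1+n p<n , fd)
... | inj₁ agree with A n Bool.≟ B n
...   | no ne = inj₂ (n , ≤-refl , agree , ne)
...   | yes eq = inj₁ λ q q<1+n →
  [ agree q , (λ q≡n → subst (λ r → A r ≡ B r) (sym q≡n) eq) ]′ (m<1+n⇒m<n∨m≡n q<1+n)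

firstDiff : ∀ A B n → A n ≢ B n → ∃ (FirstDiff A B)
firstDiff A B n ne with agree-or-firstDiff A B (suc n)
... | inj₁ agree = ⊥-elim (ne (agree n ≤-refl))
... | inj₂ (p , _ , fd) = p , fd

≺⇒firstDiff : ∀ {A B p} → FirstDiff A B p → A ≺ B → B p ≡ true
≺⇒firstDiff {A} {B} {p} (agree , ne) (p′ , agree′ , Ap′ , Bp′) with <-cmp p p′
... | tri< p<p′ _ _ = ⊥-elim (ne (agree′ p p<p′))
... | tri≈ _ refl _ = Bp′
... | tri> _ _ p′<p = ⊥-elim (true≢false Bp′ (trans (sym (agree p′ p′<p)) Ap′))

firstDiff⇒≺ : ∀ {A B p} → FirstDiff A B p → B p ≡ true → A ≺ B
firstDiff⇒≺ {A} {B} {p} (agree , ne) Bp = p , agree , ¬true⇒false (λ Ap → ne (trans Ap (sym Bp))) , Bp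

≺-connex : ∀ {A B p} → FirstDiff A B p → A ≺ B ⊎ B ≺ A
≺-connex {B = B} {p} fd with B p Bool.≟ true
... | yes Bp = inj₁ (firstDiff⇒≺ fd Bp)
... | no ¬Bp = inj₂ (firstDiff⇒≺ (FirstDiff-sym fd) (trans (¬-not (proj₂ fd)) (cong not (¬true⇒false ¬Bp))))

≺-upto : ∀ {A B B′ p} → FirstDiff A B p → (∀ q → q ≤ p → B q ≡ B′ q) → A ≺ B → A ≺ B′
≺-upto fd eq A≺B = firstDiff⇒≺ (FirstDiff-congʳ fd eq) (trans (sym (eq _ ≤-refl)) (≺⇒firstDiff fd A≺B))

-- Compare A with S below the position p where B drops under S: if they differ first at q ≤ p, then
-- either A drops under S at q, or A rises above S there and hence above B.
≼-≺-trans : ∀ {A B S} → ¬ B ≺ A → B ≺ S → A ≺ S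
≼-≺-trans {A} {B} {S} B⊀A (p , agree , Bp , Sp) with agree-or-firstDiff A S (suc p)
... | inj₁ agreeA = ⊥-elim (B⊀A (p , (λ q q<p → trans (agree q q<p) (sym (agreeA q (m<n⇒m<1+n q<p)))) ,
                                   Bp , trans (agreeA p ≤-refl) Sp))
... | inj₂ (q , q<1+p , fd@(agreeA , A≢S)) with S q Bool.≟ true
...   | yes Sq = firstDiff⇒≺ fd Sq
...   | no ¬Sq = ⊥-elim (B⊀A (q , (λ r r<q → trans (agree r (<-trans r<q q<p)) (sym (agreeA r r<q))) ,
                                trans (agree q q<p) Sq , trans (¬-not A≢S) (cong not Sq)))
  where
  Sq : S q ≡ false
  Sq = ¬true⇒false ¬Sq
  q<p : q < p
  q<p = ≤∧≢⇒< (≤-pred q<1+p) λ q≡p → ¬Sq (subst (λ r → S r ≡ true) (sym q≡p) Sp)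

_⇔ᵇ_ : Bool → Bool → Bool
a ⇔ᵇ b = (a ∧ b) ∨ (not a ∧ not b)

⇔ᵇ-true⁻ : ∀ a b → (a ⇔ᵇ b) ≡ true → a ≡ b
⇔ᵇ-true⁻ true true _ = refl
⇔ᵇ-true⁻ false false _ = refl

⇔ᵇ-refl : ∀ a → (a ⇔ᵇ a) ≡ true
⇔ᵇ-refl true = refl
⇔ᵇ-refl false = refl

agreeBelow : ℕ → (ℕ → Bool) → (ℕ → Bool) → Bool
agreeBelow p A B = not (anyBelow p λ q → not (A q ⇔ᵇ B q))

lexBelow : ℕ → (ℕ → Bool) → (ℕ → Bool) → Bool
lexBelow b A B = anyBelow b λ p → agreeBelow p A B ∧ (not (A p) ∧ B p)

agreeBelow⁻ : ∀ p A B → agreeBelow p A B ≡ true → ∀ q → q < p → A q ≡ B q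
agreeBelow⁻ p A B e q q<p = ⇔ᵇ-true⁻ _ _ (not-false⁻ (anyBelow-false⁻ p _ (not-true⁻ e) q q<p))

agreeBelow⁺ : ∀ p A B → (∀ q → q < p → A q ≡ B q) → agreeBelow p A B ≡ true
agreeBelow⁺ p A B agree = not-true⁺ (anyBelow-false⁺ p _ λ q q<p →
  not-false⁺ (subst (λ b → (A q ⇔ᵇ b) ≡ true) (agree q q<p) (⇔ᵇ-refl (A q))))

lexBelow-sound : ∀ b A B → lexBelow b A B ≡ true → A ≺ B
lexBelow-sound b A B e with p , _ , e′ ← anyBelow⁻ b _ e with agree , diff ← ∧-true⁻ {agreeBelow p A B} e′
  with Ap , Bp ← ∧-true⁻ {not (A p)} diff = p , agreeBelow⁻ p A B agree , not-true⁻ Ap , Bp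

lexBelow-complete : ∀ b A B → (∀ p → B p ≡ true → p < b) → A ≺ B → lexBelow b A B ≡ true
lexBelow-complete b A B bounded (p , agree , Ap , Bp) =
  anyBelow⁺ b _ p (bounded p Bp) (∧-true⁺ (agreeBelow⁺ p A B agree) (∧-true⁺ (not-true⁺ Ap) Bp))

_⇔ᶠ_ : ∀ {n} → Fm n → Fm n → Fm n
φ ⇔ᶠ ψ = orF (andF φ ψ) (andF (notF φ) (notF ψ))

-- The three formulas below spell out lexBelow in de Bruijn notation; the functions they compute
-- are checked against lexBelow by conversion.
approxFm : Fm 2
approxFm = exF (v 0) (andF (notF (exF (v 0) (notF (memF (v 3) (v 0) ⇔ᶠ appF stageFm (v 2 ∷ v 0 ∷ [])))))
  (andF (notF (memF (v 2) (v 0))) (appF stageFm (v 1 ∷ v 0 ∷ []))))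

notAboveFm : Fm 2
notAboveFm = notF (exF (v 0) (andF (notF (exF (v 0) (notF (memF (v 3) (v 0) ⇔ᶠ memF (v 2) (v 0)))))
  (andF (notF (memF (v 2) (v 0))) (memF (v 1) (v 0)))))

notAboveOracleFm : Fm 1
notAboveOracleFm = notF (exF (v 0) (andF (notF (exF (v 0) (notF (orcF (v 0) ⇔ᶠ memF (v 2) (v 0)))))
  (andF (notF (orcF (v 0))) (memF (v 1) (v 0)))))

module Plain = Compile ∅ χ∅ (λ _ → ev-orc0 λ ())

-- Classes of cuts

_≼ᵇ_ : ℕ → ℕ → Bool
a ≼ᵇ b = not (lexBelow a (setOf b) (setOf a))

≼ᵇ-true⁻ : ∀ a b → (a ≼ᵇ b) ≡ true → ¬ setOf b ≺ setOf a
≼ᵇ-true⁻ a b e b≺a = true≢false (lexBelow-complete a _ _ (setOf-bounded a) b≺a) (not-true⁻ e)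

≼ᵇ-false⁻ : ∀ a b → (a ≼ᵇ b) ≡ false → setOf b ≺ setOf a
≼ᵇ-false⁻ a b e = lexBelow-sound a _ _ (not-false⁻ e)

witness : Vec ℕ 2 → Vec Bool 2
witness xs = not (lookup xs F.zero ≼ᵇ lookup xs (F.suc F.zero)) ∷ lookup xs F.zero ≼ᵇ lookup xs (F.suc F.zero) ∷ []

witness-computable : ComputableWitness 1 witness
witness-computable F.zero = Plain.Fm-computable (notF notAboveFm)
witness-computable (F.suc F.zero) = Plain.Fm-computable notAboveFm

IsCut : (ℕ → Bool) → (ℕ → Bool) → Set
IsCut S g = ∀ x → (g x ≡ true → setOf x ≺ S) × (setOf x ≺ S → g x ≡ true)

witness-correct : ∀ H → (∀ g → H g → ∃ λ S → IsCut S g) → IsWitness 1 H witness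
witness-correct H cut (a ∷ b ∷ []) _ g Hg eq with cut g Hg | a ≼ᵇ b in a≼b
... | S , gS | true = true≢false
  (proj₂ (gS a) (≼-≺-trans (≼ᵇ-true⁻ a b a≼b) (proj₁ (gS b) (sym (∷-injectiveˡ (∷-injectiveʳ eq))))))
  (sym (∷-injectiveˡ eq))
... | S , gS | false = true≢false
  (proj₂ (gS b) (≺-trans (≼ᵇ-false⁻ a b a≼b) (proj₁ (gS a) (sym (∷-injectiveˡ eq)))))
  (sym (∷-injectiveˡ (∷-injectiveʳ eq)))

cuts-witness : ∀ H → (∀ g → H g → ∃ λ S → IsCut S g) → HasComputableWitness H 1
cuts-witness H cut = witness , witness-computable , witness-correct H cut

singleton-increasing : ∀ x → StrictlyIncreasing (x ∷ [])
singleton-increasing x F.zero F.zero ()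

no-0-witness : ∀ {H g₁ g₂ x} → H g₁ → H g₂ → g₁ x ≡ true → g₂ x ≡ false → ¬ HasComputableWitness H 0
no-0-witness {x = x} H₁ H₂ g₁x g₂x (f , _ , isW) with f (x ∷ []) in fx
... | true ∷ [] = isW (x ∷ []) (singleton-increasing x) _ H₁ (trans fx (cong (_∷ []) (sym g₁x)))
... | false ∷ [] = isW (x ∷ []) (singleton-increasing x) _ H₂ (trans fx (cong (_∷ []) (sym g₂x)))

eVCdim≡1 : ∀ {H g₁ g₂} x → HasComputableWitness H 1 → H g₁ → H g₂ → g₁ x ≡ true → g₂ x ≡ false →
  eVCdim≡ H 1
eVCdim≡1 x w H₁ H₂ g₁x g₂x = w , λ { zero _ → no-0-witness H₁ H₂ g₁x g₂x ; (suc m) (s≤s ()) }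

-- Undecidability of K

Eval-deterministic : ∀ {O n} {c : Code n} {xs y y′} → Eval O c xs y → Eval O c xs y′ → y ≡ y′
EvalVec-deterministic : ∀ {O n m} {cs : Vec (Code n) m} {xs ys ys′} →
  EvalVec O cs xs ys → EvalVec O cs xs ys′ → ys ≡ ys′

Eval-deterministic ev-zer ev-zer = refl
Eval-deterministic (ev-succ x) (ev-succ .x) = refl
Eval-deterministic (ev-proj i xs) (ev-proj .i .xs) = refl
Eval-deterministic (ev-comp es e) (ev-comp es′ e′) with refl ← EvalVec-deterministic es es′ = Eval-deterministic e e′
Eval-deterministic (ev-prec0 e) (ev-prec0 e′) = Eval-deterministic e e′
Eval-deterministic (ev-precS e₁ e₂) (ev-precS e₁′ e₂′) with refl ← Eval-deterministic e₁ e₁′ =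
  Eval-deterministic e₂ e₂′
Eval-deterministic (ev-mu {k = k} e ps) (ev-mu {k = k′} e′ ps′) with <-cmp k k′
... | tri< k<k′ _ _ = let (_ , e″) = ps′ k k<k′ in ⊥-elim (0≢1+n (Eval-deterministic e e″))
... | tri≈ _ k≡k′ _ = k≡k′
... | tri> _ _ k′<k = let (_ , e″) = ps k′ k′<k in ⊥-elim (0≢1+n (Eval-deterministic e′ e″))
Eval-deterministic (ev-orc1 _) (ev-orc1 _) = refl
Eval-deterministic (ev-orc1 o) (ev-orc0 ¬o) = ⊥-elim (¬o o)
Eval-deterministic (ev-orc0 ¬o) (ev-orc1 o) = ⊥-elim (¬o o)
Eval-deterministic (ev-orc0 _) (ev-orc0 _) = refl

EvalVec-deterministic ev-[] ev-[] = refl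
EvalVec-deterministic (ev-∷ e es) (ev-∷ e′ es′) = cong₂ _∷_ (Eval-deterministic e e′) (EvalVec-deterministic es es′)

-- Programs with the same number compute the same values: certify a run of one and read the
-- certificate back for the other.
Eval-transfer : ∀ {n} {c d : Code n} {v y} → ⌜ c ⌝ ≡ ⌜ d ⌝ → Eval ∅ c v y → Eval ∅ d v y
Eval-transfer {c = c} {d} eq ev with (xs , D) , p ← certify-eval ev =
  valid⇒sound (encList xs) (Derivation⇒valid D) _ (setOf-encList p) 0 (cd c) _ _ refl
    _ d _ (trans (cd≡⌜⌝ d) (trans (sym eq) (sym (cd≡⌜⌝ c)))) refl

K-undecidable : ¬ DecidableIn ∅ K
K-undecidable (D , decides) = diag∉K diag∈K
  where
  diag : Code 1
  diag = mu (comp D (proj (F.suc F.zero) ∷ []))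
  rejects : ∀ {x y} → Eval ∅ diag (x ∷ []) y → Eval ∅ D (x ∷ []) 0
  rejects (ev-mu (ev-comp (ev-∷ (ev-proj _ _) ev-[]) r) _) = r
  diag∉K : ¬ K ⌜ diag ⌝
  diag∉K Kd@(c , c≡d , y , ev) =
    0≢1+n (Eval-deterministic (rejects (Eval-transfer c≡d ev)) (proj₁ (decides ⌜ diag ⌝) Kd))
  diag∈K : K ⌜ diag ⌝
  diag∈K = diag , refl , 0 , ev-mu (ev-comp (ev-∷ (ev-proj _ _) ev-[]) (proj₂ (decides ⌜ diag ⌝) diag∉K)) λ _ ()

module PlugOracle {O : Oracle} (c : Code 1)
  (c-decides : ∀ x → (O x → Eval ∅ c (x ∷ []) 1) × (¬ O x → Eval ∅ c (x ∷ []) 0)) where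
  plug : ∀ {n} → Code n → Code n
  plugs : ∀ {m n} → Vec (Code n) m → Vec (Code n) m
  plug zer = zer
  plug succ = succ
  plug (proj i) = proj i
  plug (comp f gs) = comp (plug f) (plugs gs)
  plug (prec f g) = prec (plug f) (plug g)
  plug (mu f) = mu (plug f)
  plug orc = c
  plugs [] = []
  plugs (g ∷ gs) = plug g ∷ plugs gs

  plug-eval : ∀ {n} {d : Code n} {xs y} → Eval O d xs y → Eval ∅ (plug d) xs y
  plugs-eval : ∀ {n m} {ds : Vec (Code n) m} {xs ys} → EvalVec O ds xs ys → EvalVec ∅ (plugs ds) xs ys
  plug-eval ev-zer = ev-zer
  plug-eval (ev-succ x) = ev-succ x
  plug-eval (ev-proj i xs) = ev-proj i xs
  plug-eval (ev-comp es e) = ev-comp (plugs-eval es) (plug-eval e)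
  plug-eval (ev-prec0 e) = ev-prec0 (plug-eval e)
  plug-eval (ev-precS e₁ e₂) = ev-precS (plug-eval e₁) (plug-eval e₂)
  plug-eval (ev-mu e ps) = ev-mu (plug-eval e) λ j j<k → let (w , e′) = ps j j<k in w , plug-eval e′
  plug-eval (ev-orc1 {x} o) = proj₁ (c-decides x) o
  plug-eval (ev-orc0 {x} ¬o) = proj₂ (c-decides x) ¬o
  plugs-eval ev-[] = ev-[]
  plugs-eval (ev-∷ e es) = ev-∷ (plug-eval e) (plugs-eval es)

DecidableIn-∅ : ∀ {O P} → DecidableIn O P → DecidableIn ∅ O → DecidableIn ∅ P
DecidableIn-∅ (c , c-decides) (o , o-decides) =
  plug c , λ x → plug-eval ∘ proj₁ (c-decides x) , plug-eval ∘ proj₂ (c-decides x)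
  where open PlugOracle o o-decides

Computable⇒DecidableIn : ∀ {g} → Computable g → DecidableIn ∅ ⟦ g ⟧
Computable⇒DecidableIn (c , ev) = c , λ x →
  (λ gx → subst (Eval ∅ c (x ∷ [])) (cong b2n gx) (ev (x ∷ []))) ,
  (λ ¬gx → subst (Eval ∅ c (x ∷ [])) (cong b2n (¬true⇒false ¬gx)) (ev (x ∷ [])))

-- The construction

hs : ℕ → ℕ → Bool
hs i n = lexBelow i (setOf n) (stage i)

hs-computable : ComputableSeq hs
hs-computable = Plain.Fm-computable approxFm

ConvergesTo-upto : ∀ {f g} → ConvergesTo f g → ∀ p → ∃ λ N → ∀ i → N ≤ i → ∀ q → q ≤ p → f i q ≡ g q
ConvergesTo-upto c zero with N , fN ← c 0 = N , λ { i N≤i .0 z≤n → fN i N≤i }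
ConvergesTo-upto {f} {g} c (suc p) with N₁ , f₁ ← ConvergesTo-upto c p | N₂ , f₂ ← c (suc p) =
  N₁ ⊔ N₂ , λ i N≤i q q≤1+p →
    [ (λ q<1+p → f₁ i (m⊔n≤o⇒m≤o N₁ N₂ N≤i) q (≤-pred q<1+p))
    , (λ q≡1+p → subst (λ r → f i r ≡ g r) (sym q≡1+p) (f₂ i (m⊔n≤o⇒n≤o N₁ N₂ N≤i))) ]′
    (m≤n⇒m<n∨m≡n q≤1+p)

module Classical (em : ExcludedMiddle 0ℓ) where
  isK : ℕ → Bool
  isK e = does (em {K e})

  h : ℕ → Bool
  h n = does (em {setOf n ≺ isK})

  isK⁺ : ∀ {e} → K e → isK e ≡ true
  isK⁺ {e} = dec-true (em {K e})

  isK-false : ∀ {e} → ¬ K e → isK e ≡ false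
  isK-false {e} = dec-false (em {K e})

  h⁺ : ∀ n → setOf n ≺ isK → h n ≡ true
  h⁺ n = dec-true (em {setOf n ≺ isK})

  h⁻ : ∀ n → h n ≡ true → setOf n ≺ isK
  h⁻ n = does-true⁻ (em {setOf n ≺ isK})

  setOf-firstDiff-isK : ∀ L → ∃ (FirstDiff (setOf L) isK)
  setOf-firstDiff-isK L with e , L≤e , Ke ← K-unbounded L =
    firstDiff (setOf L) isK e λ eq → <⇒≱ (setOf-bounded L e (trans eq (isK⁺ Ke))) L≤e

  stage-converges : ConvergesTo stage isK
  stage-converges e with em {K e}
  ... | yes Ke = K⇒stage e Ke
  ... | no ¬Ke = 0 , λ i _ → ¬true⇒false (¬Ke ∘ stage⇒K i e)

  hs-converges : ConvergesTo hs h
  hs-converges n with p , fd ← setOf-firstDiff-isK n with N , agree ← ConvergesTo-upto stage-converges p =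
    N , λ i N≤i → bool-ext
      (λ hsᵢ → h⁺ n (≺-upto (FirstDiff-congʳ fd λ q q≤p → sym (agree i N≤i q q≤p)) (agree i N≤i)
                    (lexBelow-sound i (setOf n) (stage i) hsᵢ)))
      (λ hn → lexBelow-complete i (setOf n) (stage i) (stage-bounded i)
                (≺-upto fd (λ q q≤p → sym (agree i N≤i q q≤p)) (h⁻ n hn)))

  class-cuts : ∀ g → SeqClass h hs g → ∃ λ S → IsCut S g
  class-cuts g (inj₁ g≗h) = isK , λ x → h⁻ x ∘ trans (sym (g≗h x)) , trans (g≗h x) ∘ h⁺ x
  class-cuts g (inj₂ (i , g≗hsᵢ)) = stage i , λ x →
    lexBelow-sound i (setOf x) (stage i) ∘ trans (sym (g≗hsᵢ x)) ,
    trans (g≗hsᵢ x) ∘ lexBelow-complete i (setOf x) (stage i) (stage-bounded i)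

  h-0 : h 0 ≡ true
  h-0 with p , fd ← setOf-firstDiff-isK 0 = h⁺ 0 (firstDiff⇒≺ fd (¬-not (proj₂ fd ∘ sym)))

  orc-K : ∀ x → Eval K orc (x ∷ []) (b2n (isK x))
  orc-K x with em {K x}
  ... | yes Kx = ev-orc1 Kx
  ... | no ¬Kx = ev-orc0 ¬Kx

  module WithK = Compile K isK orc-K

  h-via-K : ∀ n → not (lexBelow n isK (setOf n)) ≡ h n
  h-via-K n with p , fd ← setOf-firstDiff-isK n = bool-ext
    (λ e → h⁺ n ([ id , (λ K≺n → ⊥-elim (true≢false (lexBelow-complete n isK (setOf n) (setOf-bounded n) K≺n)
                                                       (not-true⁻ e))) ]′ (≺-connex fd)))
    (λ hn → not-true⁺ (¬true⇒false λ lex → ≺-asym (h⁻ n hn) (lexBelow-sound n isK (setOf n) lex)))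

  h≤TK : ⟦ h ⟧ ≤T K
  h≤TK = WithK.decides notAboveOracleFm λ n →
    (λ hn → trans (h-via-K n) hn) , (λ ¬hn → trans (h-via-K n) (¬true⇒false ¬hn))

  Codes : ℕ → ℕ → Set
  Codes R p = ∀ q → (setOf R q ≡ true → q < p × isK q ≡ true) × (q < p → isK q ≡ true → setOf R q ≡ true)

  module _ {R p} (c : Codes R p) where
    setOf-π-below : ∀ {q} → q < p → setOf (π p R) q ≡ isK q
    setOf-π-below {q} q<p = bool-ext
      (λ m → [ (λ p≡q → ⊥-elim (<-irrefl (sym p≡q) q<p)) , (λ m′ → proj₂ (proj₁ (c q) m′)) ]′
               (setOf-π⁻ p R q m))
      (λ Kq → setOf-π⁺ p R q (inj₂ (proj₂ (c q) q<p Kq)))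

    setOf-π-at : setOf (π p R) p ≡ true
    setOf-π-at = setOf-π⁺ p R p (inj₁ refl)

    setOf-π-above : ∀ {q} → p < q → setOf (π p R) q ≡ false
    setOf-π-above {q} p<q = ¬true⇒false λ m →
      [ (λ p≡q → <-irrefl p≡q p<q) , (λ m′ → <-asym p<q (proj₁ (proj₁ (c q) m′))) ]′ (setOf-π⁻ p R q m)

    -- Up to p the list p ∷ R agrees with K except possibly at p; beyond p it is empty and K is not.
    h-extends : h (π p R) ≡ isK p
    h-extends with isK p in Kp
    ... | false = ¬true⇒false λ hσ → ≺-asym (h⁻ (π p R) hσ)
      (firstDiff⇒≺ ((λ q q<p → sym (setOf-π-below q<p)) , λ e → true≢false setOf-π-at (trans (sym e) Kp)) setOf-π-at)
    ... | true with r , fd ← setOf-firstDiff-isK (π p R) with <-cmp r p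
    ...   | tri< r<p _ _ = ⊥-elim (proj₂ fd (setOf-π-below r<p))
    ...   | tri≈ _ refl _ = ⊥-elim (proj₂ fd (trans setOf-π-at (sym Kp)))
    ...   | tri> _ _ p<r =
      h⁺ (π p R) (firstDiff⇒≺ fd (trans (¬-not (proj₂ fd ∘ sym)) (cong not (setOf-π-above p<r))))

    Codes-step : Codes (if isK p then π p R else R) (suc p)
    Codes-step with isK p in Kp
    ... | true = λ q →
      (λ m → [ (λ p≡q → subst (λ r → r < suc p × isK r ≡ true) p≡q (≤-refl , Kp))
             , (λ m′ → let (q<p , Kq) = proj₁ (c q) m′ in m<n⇒m<1+n q<p , Kq) ]′ (setOf-π⁻ p R q m)) ,
      (λ q<1+p Kq → setOf-π⁺ p R q
        ([ (λ q<p → inj₂ (proj₂ (c q) q<p Kq)) , (λ q≡p → inj₁ (sym q≡p)) ]′ (m<1+n⇒m<n∨m≡n q<1+p)))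
    ... | false = λ q →
      (λ m → let (q<p , Kq) = proj₁ (c q) m in m<n⇒m<1+n q<p , Kq) ,
      (λ q<1+p Kq → proj₂ (c q)
        (≤∧≢⇒< (≤-pred q<1+p) λ q≡p → true≢false (subst (λ r → isK r ≡ true) q≡p Kq) Kp) Kq)

  prefixT : Tm 1
  prefixT = itT (lit 0) (ifT (orcF (pairT (v 0) (v 1))) (pairT (v 0) (v 1)) (v 1)) (v 0)

  prefix : ℕ → ℕ
  prefix p = ⟦ prefixT ⟧ₜ h (p ∷ [])

  prefix-codes : ∀ p → Codes (prefix p) p
  prefix-codes zero q = (λ ()) , λ ()
  prefix-codes (suc p) = subst (λ b → Codes (if b then π p (prefix p) else prefix p) (suc p))
    (sym (h-extends (prefix-codes p))) (Codes-step (prefix-codes p))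

  orc-h : ∀ x → Eval ⟦ h ⟧ orc (x ∷ []) (b2n (h x))
  orc-h x with h x in hx
  ... | true = ev-orc1 hx
  ... | false = ev-orc0 λ e → true≢false e hx

  module WithH = Compile ⟦ h ⟧ h orc-h

  K≤Th : K ≤T ⟦ h ⟧
  K≤Th = WithH.decides (orcF (pairT (v 0) prefixT)) λ e →
    (λ Ke → trans (h-extends (prefix-codes e)) (isK⁺ Ke)) ,
    (λ ¬Ke → trans (h-extends (prefix-codes e)) (isK-false ¬Ke))

  h-not-computable : ¬ Computable h
  h-not-computable = K-undecidable ∘ DecidableIn-∅ K≤Th ∘ Computable⇒DecidableIn

proposition74 : ExcludedMiddle 0ℓ →
    Σ (ℕ → ℕ → Bool) λ hs → Σ (ℕ → Bool) λ h →
      ComputableSeq hs × ConvergesTo hs h × ¬ Computable h × HasDegree0′ h ×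
      eVCdim≡ (SeqClass h hs) 1
proposition74 em =
  hs , h , hs-computable , hs-converges , h-not-computable , (h≤TK , K≤Th) ,
  eVCdim≡1 0 (cuts-witness (SeqClass h hs) class-cuts) (inj₁ λ _ → refl) (inj₂ (0 , λ _ → refl)) h-0 refl
  where open Classical em
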